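{- Let $k\in\{9,10\}$ and let $G,\mathcal{F},G',\mathcal{W}$ be as in the context. Let $K$ be a connected component of $\mathcal{F}+\mathcal{W}$ such that $(K)_m$ is not a single node and $K$ contains no 2-anchor. Then $K$ has a $k$-pp with at least $\frac45|F_K|$ edges, where $F_K=E(K)\cap E(\mathcal{F})$.
   Context: $G=(V,E)$ is a simple undirected graph. A $k$-pp of a graph is a spanning subgraph whose components are paths with at most $k$ vertices. A path-cycle cover is a spanning subgraph whose components are paths or cycles; $\mathcal{F}$ is a triangle-free one (no 3-cycle components) of $G$ with maximum number of edges. A short cycle is a cycle component of $\mathcal{F}$ with 4 or 5 vertices. $G'$ is the spanning subgraph of $G$ with edges $\{u,v\}\in E$ such that $u,v$ lie in different components of $\mathcal{F}$ and at least one lies in a short cycle. A 4-vertex cycle of $\mathcal{F}$ is saturated by $E'\subseteq E(G')$ if some edge of $E'$ is incident to one of its vertices; the weight of $E'$ is the number of 4-vertex cycles of $\mathcal{F}$ saturated by $E'$. $\mathcal{W}$ is a path-cycle cover of $G'$ maximizing the weight of $E(\mathcal{W})$ and stingy (removing any edge of $\mathcal{W}$ strictly decreases the weight). $\mathcal{F}+\mathcal{W}=(V,E(\mathcal{F})\cup E(\mathcal{W}))$. For a component $K$ of $\mathcal{F}+\mathcal{W}$, $(K)_m$ is obtained by contracting each component of $\mathcal{F}$ in $K$ to a node, nodes adjacent iff $\mathcal{W}$ has an edge between the corresponding components; $(K)_m$ is always a single node, an edge or a star (one center of degree $\ge2$, all other nodes of degree 1). The center element $K_c$ of $K$ is the component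 of $\mathcal{F}$ corresponding to: the unique node if $(K)_m$ is a single node; the center if $(K)_m$ is a star; if $(K)_m$ is an edge, an endpoint chosen so that the other endpoint corresponds to a 4-vertex cycle of $\mathcal{F}$ (such a choice always exists; it is arbitrary if both qualify). A vertex of $K_c$ is a $j$-anchor ($j\in\{0,1,2\}$) if it is incident to exactly $j$ edges of $\mathcal{W}$. -}

module Defs where

open import Data.Nat using (ℕ; zero; suc; _≤_; _<_)
open import Data.Fin using (Fin; toℕ; _≟_)
import Data.Fin as F
open import Data.Bool using (Bool; true; false; _∨_; _∧_; not)
open import Data.Product using (Σ; ∃; _×_; _,_)
open import Data.Sum using (_⊎_)
open import Relation.Nullary using (¬_)
open import Relation.Nullary.Decidable using (⌊_⌋)
open import Relation.Binary.PropositionalEquality using (_≡_)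
open import Function.Definitions using (Injective)

-- A (simple, undirected) graph / edge set on vertex set Fin n, given by its
-- Bool-valued adjacency; simplicity is imposed separately by SimpleGraph.
Graph : ℕ → Set
Graph n = Fin n → Fin n → Bool

-- Set-valued edge relations (used for G', whose definition is not decidable a priori)
Rel : ℕ → Set₁
Rel n = Fin n → Fin n → Set

⟦_⟧ : ∀ {n} → Graph n → Rel n
⟦ H ⟧ u v = H u v ≡ true

Symmetric : ∀ {n} → Graph n → Set
Symmetric {n} H = (u v : Fin n) → H u v ≡ true → H v u ≡ true

SimpleGraph : ∀ {n} → Graph n → Set
SimpleGraph {n} G = Symmetric G × ((v : Fin n) → G v v ≡ false)

Iff : Set → Set → Set
Iff A B = (A → B) × (B → A)

HasSize : {A : Set} → (A → Set) → ℕ → Set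
HasSize {A} P c = Σ (Fin c → A) λ f → Injective _≡_ _≡_ f × ((a : A) → Iff (P a) (∃ λ i → f i ≡ a))

data Reach {n : ℕ} (H : Graph n) : Fin n → Fin n → Set where
  here : ∀ {v} → Reach H v v
  step : ∀ {u w v} → H u w ≡ true → Reach H w v → Reach H u v

PathAdj : ∀ {m} → Fin m → Fin m → Set
PathAdj i j = (suc (toℕ i) ≡ toℕ j) ⊎ (suc (toℕ j) ≡ toℕ i)

CycleAdj : ∀ m → Fin m → Fin m → Set
CycleAdj m i j = PathAdj i j ⊎ ((toℕ i ≡ 0 × suc (toℕ j) ≡ m) ⊎ (toℕ j ≡ 0 × suc (toℕ i) ≡ m))

ComponentIsPath : ∀ {n} → Graph n → Fin n → ℕ → Set
ComponentIsPath {n} H r m =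
  Σ (Fin m → Fin n) λ f → Injective _≡_ _≡_ f
    × ((v : Fin n) → Iff (Reach H r v) (∃ λ i → f i ≡ v))
    × ((i j : Fin m) → Iff (H (f i) (f j) ≡ true) (PathAdj i j))

ComponentIsCycle : ∀ {n} → Graph n → Fin n → ℕ → Set
ComponentIsCycle {n} H r m = 3 ≤ m ×
  (Σ (Fin m → Fin n) λ f → Injective _≡_ _≡_ f
    × ((v : Fin n) → Iff (Reach H r v) (∃ λ i → f i ≡ v))
    × ((i j : Fin m) → Iff (H (f i) (f j) ≡ true) (CycleAdj m i j)))

SpanningSubgraph : ∀ {n} → Rel n → Graph n → Set
SpanningSubgraph {n} R H = Symmetric H × ((u v : Fin n) → H u v ≡ true → R u v)

PathCycleCover : ∀ {n} → Rel n → Graph n → Set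
PathCycleCover {n} R H = SpanningSubgraph R H ×
  ((r : Fin n) → (∃ λ m → ComponentIsPath H r m) ⊎ (∃ λ m → ComponentIsCycle H r m))

TriangleFree : ∀ {n} → Graph n → Set
TriangleFree {n} H = (r : Fin n) → ¬ ComponentIsCycle H r 3

-- edges of H as unordered pairs, represented by (u , v) with u < v
EdgeSet : ∀ {n} → Graph n → Fin n × Fin n → Set
EdgeSet H (u , v) = toℕ u < toℕ v × H u v ≡ true

NumEdges : ∀ {n} → Graph n → ℕ → Set
NumEdges H c = HasSize (EdgeSet H) c

MaxTFPCC : ∀ {n} → Graph n → Graph n → Set
MaxTFPCC {n} G F = PathCycleCover ⟦ G ⟧ F × TriangleFree F ×
  ((H : Graph n) → PathCycleCover ⟦ G ⟧ H → TriangleFree H →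
     (a b : ℕ) → NumEdges H a → NumEdges F b → a ≤ b)

Short : ∀ {n} → Graph n → Fin n → Set
Short F v = ComponentIsCycle F v 4 ⊎ ComponentIsCycle F v 5

G'Adj : ∀ {n} → Graph n → Graph n → Rel n
G'Adj G F u v = G u v ≡ true × ¬ Reach F u v × (Short F u ⊎ Short F v)

Saturates : ∀ {n} → Graph n → Graph n → Fin n → Set
Saturates F E' v = ∃ λ u → ∃ λ w → Reach F v u × E' u w ≡ true

-- weight of E': number of 4-cycles of F saturated by E'; each such cycle is
-- counted once, through its least vertex
Weight : ∀ {n} → Graph n → Graph n → ℕ → Set
Weight {n} F E' c = HasSize (λ v → ComponentIsCycle F v 4
                                   × ((u : Fin n) → Reach F v u → v F.≤ u)
                                   × Saturates F E' v) c

removeEdge : ∀ {n} → Graph n → Fin n → Fin n → Graph n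
removeEdge W a b u v =
  W u v ∧ not ((⌊ u ≟ a ⌋ ∧ ⌊ v ≟ b ⌋) ∨ (⌊ u ≟ b ⌋ ∧ ⌊ v ≟ a ⌋))

-- W is a stingy path-cycle cover of G' of maximum weight
OptimalW : ∀ {n} → Graph n → Graph n → Graph n → Set
OptimalW {n} G F W = PathCycleCover (G'Adj G F) W
  × ((W' : Graph n) → PathCycleCover (G'Adj G F) W' →
       (a b : ℕ) → Weight F W' a → Weight F W b → a ≤ b)
  × ((a b : Fin n) → W a b ≡ true →
       (c d : ℕ) → Weight F (removeEdge W a b) c → Weight F W d → c < d)

_⊕_ : ∀ {n} → Graph n → Graph n → Graph n
(F ⊕ W) u v = F u v ∨ W u v

InK : ∀ {n} → Graph n → Graph n → Fin n → Fin n → Set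
InK F W r v = Reach (F ⊕ W) r v

-- (K)_m is not a single node: K meets at least two components of F
NotSingleNode : ∀ {n} → Graph n → Graph n → Fin n → Set
NotSingleNode F W r = ∃ λ u → ∃ λ v → InK F W r u × InK F W r v × ¬ Reach F u v

CompAdj : ∀ {n} → Graph n → Graph n → Fin n → Fin n → Set
CompAdj F W x y = ¬ Reach F x y × (∃ λ u → ∃ λ v → Reach F x u × Reach F y v × W u v ≡ true)

-- the F-component of c is a (valid choice of) center element K_c of K (for (K)_m not a single node)
IsCenter : ∀ {n} → Graph n → Graph n → Fin n → Fin n → Set
IsCenter {n} F W r c = InK F W r c ×
  ( -- star case: the node of c has degree ≥ 2 in (K)_m
    (∃ λ x → ∃ λ y → InK F W r x × InK F W r y × CompAdj F W c x × CompAdj F W c y × ¬ Reach F x y)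
  ⊎ -- edge case: K has exactly two F-components, the other one a 4-cycle
    (∃ λ d → InK F W r d × ¬ Reach F c d
       × ((v : Fin n) → InK F W r v → Reach F c v ⊎ Reach F d v)
       × ComponentIsCycle F d 4))

TwoAnchor : ∀ {n} → Graph n → Fin n → Set
TwoAnchor W v = HasSize (λ u → W v u ≡ true) 2

NoTwoAnchor : ∀ {n} → Graph n → Graph n → Fin n → Set
NoTwoAnchor {n} F W c = (v : Fin n) → Reach F c v → ¬ TwoAnchor W v

IsKPP : ∀ {n} → ℕ → Graph n → Graph n → Fin n → Graph n → Set
IsKPP {n} k F W r P =
  SpanningSubgraph (λ u v → (F ⊕ W) u v ≡ true × InK F W r u) P
  × ((v : Fin n) → InK F W r v → ∃ λ m → m ≤ k × ComponentIsPath P v m)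

FK : ∀ {n} → Graph n → Graph n → Fin n → Fin n × Fin n → Set
FK F W r (u , v) = toℕ u < toℕ v × F u v ≡ true × InK F W r u

-- The component K consists of its centre C = K_c and, for every anchor x of C, the component D_x of F
-- joined to x by a W-edge x y_x.  As x is no 2-anchor it has only this W-neighbour, and stinginess of W
-- forces D_x to be a 4-cycle whose only W-edge is x y_x.  Walk along C, starting at an anchor when C is a
-- cycle, and replace every anchor x by a path through D_x ending at y_x followed by x.  Cutting this
-- sequence before every anchor yields paths of F + W with at least five vertices, except for an initial
-- segment that exists only when C is a path; cut each of them into pieces of five to nine vertices, the
-- initial segment possibly leaving one shorter piece.  With N = |V(K)|, p pieces and δ = 1 if C is a path,
-- δ = 0 otherwise, the pieces form a k-pp with N − p edges and 5p ≤ N + 4δ, while |F_K| ≤ N − δ since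
-- every component of F has at most as many edges as vertices and a path has one fewer.
-- Hence 4|F_K| ≤ 4(N − δ) ≤ 5(N − p).

module Submission where

open import Defs
open import Data.Nat using (ℕ; _≤_; _*_)
open import Data.Fin using (Fin)
open import Data.Product using (∃; _×_)
open import Data.Sum using (_⊎_)
open import Relation.Binary.PropositionalEquality using (_≡_)

open import Data.Nat using (zero; suc; _+_; _∸_; _<_; _<?_; z≤n; s≤s)
open import Data.Bool using (Bool; true; false; _∨_; _∧_)
import Data.Bool.Properties as Bool
open import Data.Empty using (⊥; ⊥-elim)
open import Data.Fin using (zero; suc; toℕ; _≟_; fromℕ; fromℕ<; inject₁) renaming (_≤_ to _≤ᶠ_)
import Data.Fin.Properties as Finₚ
open import Data.Fin.Properties using (any?; all?; injective⇒≤; toℕ-injective; toℕ-fromℕ; toℕ-fromℕ<; toℕ-inject₁; toℕ<n)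
open import Data.List using (List; []; _∷_; _++_; concat; concatMap; map; length; lookup; filter; tabulate; take; drop; allFin; cartesianProduct)
open import Data.Nat.ListAction using (sum)
import Data.Nat as ℕ
open import Data.Nat.Tactic.RingSolver using (solve-∀)
open import Data.List.Properties using (length-++; filter-++; filter-accept; filter-reject; ++-identityʳ; ++-assoc; filter-≐; concat-++; take++drop≡id; ∷-injective; ∷-injectiveˡ; ∷ʳ-injective)
open import Data.List.Relation.Binary.Permutation.Propositional using (_↭_; ↭-sym; ↭-trans; ↭-reflexive; ↭⇒↭ₛ)
open import Data.List.Relation.Binary.Permutation.Propositional.Properties using (++-comm; ∈-resp-↭)
open import Data.List.Relation.Binary.Permutation.Setoid.Properties using (Unique-resp-↭)
import Data.List.Membership.DecPropositional as DecMembership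
open import Data.List.Membership.Propositional using (_∈_)
open import Data.List.Membership.Propositional.Properties using (∈-lookup; ∈-filter⁺; ∈-filter⁻; ∈-concat⁺′; ∈-concat⁻′; ∈-map⁺; ∈-map⁻; ∈-tabulate⁺; ∈-tabulate⁻; ∈-allFin; ∈-++⁺ˡ; ∈-++⁺ʳ; ∈-++⁻; ∈-cartesianProduct⁺)
open import Data.List.Relation.Binary.Disjoint.Propositional using (Disjoint)
open import Data.List.Relation.Unary.All using (All; []; _∷_) renaming (lookup to All-lookup)
import Data.List.Relation.Unary.All as All
open import Data.List.Relation.Unary.AllPairs using (AllPairs; []; _∷_)
import Data.List.Relation.Unary.AllPairs.Properties as AllPairs
open import Data.List.Relation.Unary.All.Properties using (++⁻ˡ; ++⁻ʳ; ¬Any⇒All¬; all-filter)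
import Data.List.Relation.Unary.All.Properties as Allₚ
open import Data.List.Relation.Unary.Any using (here; there; index)
open import Data.List.Relation.Unary.Any.Properties using (lookup-index)
open import Data.List.Relation.Unary.Unique.Propositional using (Unique)
import Data.List.Relation.Unary.Unique.Propositional.Properties as Uniqueₚ
open Uniqueₚ using (Unique[x∷xs]⇒x∉xs)
open import Data.Maybe using (Maybe; just; nothing; maybe′)
open import Data.Maybe.Properties using (just-injective)
open import Data.Nat.Properties using (≤-antisym; suc-injective; <-asym; <-irrefl; ≮⇒≥; ≤-refl; ≤-trans; ≤-reflexive; *-zeroʳ; *-suc; *-distribˡ-+; *-monoʳ-≤; +-cancelʳ-≤; +-suc; +-assoc; +-comm; +-identityʳ; n≤1+n; +-commutativeSemigroup; +-mono-≤; +-monoʳ-≤; +-monoˡ-≤; m≤m+n; _≤?_; module ≤-Reasoning)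
open import Algebra.Properties.CommutativeSemigroup +-commutativeSemigroup using (xy∙z≈xz∙y)
open import Data.Product using (Σ; _,_; proj₁; proj₂)
open import Data.Product.Properties using (≡-dec)
open import Data.Sum using (inj₁; inj₂)
import Data.Sum as Sum
open import Data.Unit using (⊤; tt)
open import Function.Definitions using (Injective)
open import Relation.Nullary using (¬_; Dec; yes; no; does)
open import Relation.Nullary.Decidable using (dec-true; map′; ⌊_⌋; _×-dec_; _→-dec_; ¬?; decidable-stable)
open import Relation.Unary using (Decidable)
open import Relation.Binary.PropositionalEquality using (refl; sym; trans; cong; cong₂; subst; subst₂; setoid; module ≡-Reasoning)
open import Function using (_∘_)

Iff-refl : ∀ {A : Set} → Iff A A
Iff-refl = (λ a → a) , (λ a → a)

module _ {A : Set} where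

  lookup-injective : {xs : List A} → Unique xs → Injective _≡_ _≡_ (lookup xs)
  lookup-injective (_ ∷ _) {zero} {zero} _ = refl
  lookup-injective (x∉xs ∷ _) {zero} {suc j} eq = ⊥-elim (All-lookup x∉xs (∈-lookup j) eq)
  lookup-injective (x∉xs ∷ _) {suc i} {zero} eq = ⊥-elim (All-lookup x∉xs (∈-lookup i) (sym eq))
  lookup-injective (_ ∷ u) {suc i} {suc j} eq = cong suc (lookup-injective u eq)

  ∈⇒lookup : ∀ {xs : List A} {x} → x ∈ xs → ∃ λ i → lookup xs i ≡ x
  ∈⇒lookup x∈ = index x∈ , sym (lookup-index x∈)

  hasSize-fromList : {P : A → Set} (xs : List A) → Unique xs → (∀ a → Iff (P a) (a ∈ xs)) →
                     HasSize P (length xs)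
  hasSize-fromList xs u P⇔∈ = lookup xs , lookup-injective u , λ a →
      (λ pa → ∈⇒lookup (proj₁ (P⇔∈ a) pa))
    , λ { (i , refl) → proj₂ (P⇔∈ _) (∈-lookup i) }

  hasSize-decidable : {P : A → Set} (xs : List A) → Unique xs → (∀ a → a ∈ xs) →
                      Decidable P → ∃ (HasSize P)
  hasSize-decidable xs u all P? = _ , hasSize-fromList (filter P? xs) (Uniqueₚ.filter⁺ P? u)
    λ a → ∈-filter⁺ P? (all a) , λ a∈ → proj₂ (∈-filter⁻ P? {xs = xs} a∈)

  Unique-++⁻ : {xs ys : List A} → Unique (xs ++ ys) → Unique xs × Unique ys × Disjoint xs ys
  Unique-++⁻ {[]} u = [] , u , λ { (() , _) }
  Unique-++⁻ {x ∷ xs} (x∉ ∷ u) with Unique-++⁻ {xs} u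
  ... | uxs , uys , disj = ++⁻ˡ xs x∉ ∷ uxs , uys , λ
    { (here refl , v∈ys) → All-lookup (++⁻ʳ xs x∉) v∈ys refl
    ; (there v∈xs , v∈ys) → disj (v∈xs , v∈ys) }

hasSize⇒dec : ∀ {n m} {P : Fin n → Set} → HasSize P m → Decidable P
hasSize⇒dec (f , _ , P⇔f) a = map′ (proj₂ (P⇔f a)) (proj₁ (P⇔f a)) (any? λ i → f i ≟ a)

module _ {A B : Set} {P : A → Set} {Q : B → Set} where

  hasSize-≤-injection : ∀ {a b} → HasSize P a → HasSize Q b → (h : A → B) → (∀ x → P x → Q (h x)) →
                        (∀ x y → P x → P y → h x ≡ h y → x ≡ y) → a ≤ b
  hasSize-≤-injection {a} {b} (f , f-inj , P⇔f) (g , _ , Q⇔g) h PQ h-inj = injective⇒≤ H-inj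
    where
    P-f : ∀ i → P (f i)
    P-f i = proj₂ (P⇔f (f i)) (i , refl)
    slot : ∀ i → ∃ λ j → g j ≡ h (f i)
    slot i = proj₁ (Q⇔g (h (f i))) (PQ (f i) (P-f i))
    H : Fin a → Fin b
    H i = proj₁ (slot i)
    H-inj : Injective _≡_ _≡_ H
    H-inj {i} {j} eq = f-inj (h-inj _ _ (P-f i) (P-f j)
      (trans (sym (proj₂ (slot i))) (trans (cong g eq) (proj₂ (slot j)))))

module _ {A : Set} {P Q : A → Set} where

  hasSize-cong : ∀ {a b} → HasSize P a → HasSize Q b → (∀ x → Iff (P x) (Q x)) → a ≡ b
  hasSize-cong HP HQ P⇔Q = ≤-antisym
    (hasSize-≤-injection HP HQ (λ x → x) (λ x → proj₁ (P⇔Q x)) (λ _ _ _ _ eq → eq))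
    (hasSize-≤-injection HQ HP (λ x → x) (λ x → proj₂ (P⇔Q x)) (λ _ _ _ _ eq → eq))

module _ {A : Set} {P : A → Set} where

  WithPoint : Maybe A → Set
  WithPoint nothing = ⊤
  WithPoint (just a) = P a

  hasSize-WithPoint : ∀ {a} → HasSize P a → HasSize WithPoint (suc a)
  hasSize-WithPoint (f , f-inj , P⇔f) = f⁺ , f⁺-inj , λ
    { nothing → (λ _ → zero , refl) , (λ _ → tt)
    ; (just x) → (λ px → let i , fi≡x = proj₁ (P⇔f x) px in suc i , cong just fi≡x)
               , λ { (suc i , refl) → proj₂ (P⇔f (f i)) (i , refl) } }
    where
    f⁺ : Fin (suc _) → Maybe A
    f⁺ zero = nothing
    f⁺ (suc i) = just (f i)
    f⁺-inj : Injective _≡_ _≡_ f⁺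
    f⁺-inj {zero} {zero} _ = refl
    f⁺-inj {zero} {suc _} ()
    f⁺-inj {suc _} {zero} ()
    f⁺-inj {suc i} {suc j} eq = cong suc (f-inj (just-injective eq))

module _ {A B : Set} {P : A → Set} {Q : B → Set} where

  hasSize-<-injection : ∀ {a b} → HasSize P a → HasSize Q b → (h : A → B) → (∀ x → P x → Q (h x)) →
                        (∀ x y → P x → P y → h x ≡ h y → x ≡ y) →
                        (b₀ : B) → Q b₀ → (∀ x → P x → ¬ h x ≡ b₀) → suc a ≤ b
  hasSize-<-injection HP HQ h PQ h-inj b₀ Qb₀ h≢b₀ =
    hasSize-≤-injection (hasSize-WithPoint HP) HQ (maybe′ h b₀) PQ⁺ h⁺-inj
    where
    PQ⁺ : ∀ x → WithPoint x → Q (maybe′ h b₀ x)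
    PQ⁺ nothing _ = Qb₀
    PQ⁺ (just x) px = PQ x px
    h⁺-inj : ∀ x y → WithPoint x → WithPoint y → maybe′ h b₀ x ≡ maybe′ h b₀ y → x ≡ y
    h⁺-inj nothing nothing _ _ _ = refl
    h⁺-inj nothing (just y) _ py eq = ⊥-elim (h≢b₀ y py (sym eq))
    h⁺-inj (just x) nothing px _ eq = ⊥-elim (h≢b₀ x px eq)
    h⁺-inj (just x) (just y) px py eq = cong just (h-inj x y px py eq)

does⇒ : ∀ {A : Set} (a? : Dec A) → does a? ≡ true → A
does⇒ (yes a) _ = a

∨-introˡ : ∀ {a b} → a ≡ true → a ∨ b ≡ true
∨-introˡ refl = refl

∨-introʳ : ∀ {a b} → b ≡ true → a ∨ b ≡ true
∨-introʳ {false} refl = refl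
∨-introʳ {true} refl = refl

∨-elim : ∀ {a b} → a ∨ b ≡ true → a ≡ true ⊎ b ≡ true
∨-elim {true} _ = inj₁ refl
∨-elim {false} eq = inj₂ eq

module _ {n : ℕ} {H : Graph n} where

  Reach-trans : ∀ {u v w} → Reach H u v → Reach H v w → Reach H u w
  Reach-trans here q = q
  Reach-trans (step e p) q = step e (Reach-trans p q)

  Reach-sym : Symmetric H → ∀ {u v} → Reach H u v → Reach H v u
  Reach-sym H-sym here = here
  Reach-sym H-sym (step e p) = Reach-trans (Reach-sym H-sym p) (step (H-sym _ _ e) here)

  reroot : Symmetric H → ∀ {x y} {Q : Fin n → Set} → Reach H x y →
           (∀ v → Iff (Reach H x v) (Q v)) → ∀ v → Iff (Reach H y v) (Q v)
  reroot H-sym x~y x⇔Q v =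
    (λ yv → proj₁ (x⇔Q v) (Reach-trans x~y yv)) , (λ q → Reach-trans (Reach-sym H-sym x~y) (proj₂ (x⇔Q v) q))

  ComponentIsPath-reroot : Symmetric H → ∀ {x y m} → Reach H x y → ComponentIsPath H x m → ComponentIsPath H y m
  ComponentIsPath-reroot H-sym x~y (f , f-inj , x⇔f , adj) = f , f-inj , reroot H-sym x~y x⇔f , adj

  ComponentIsCycle-reroot : Symmetric H → ∀ {x y m} → Reach H x y → ComponentIsCycle H x m → ComponentIsCycle H y m
  ComponentIsCycle-reroot H-sym x~y (3≤m , f , f-inj , x⇔f , adj) = 3≤m , f , f-inj , reroot H-sym x~y x⇔f , adj

Reach-map : ∀ {n} {H H′ : Graph n} → (∀ u v → H u v ≡ true → H′ u v ≡ true) →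
            ∀ {u v} → Reach H u v → Reach H′ u v
Reach-map H⊆H′ here = here
Reach-map H⊆H′ (step e p) = step (H⊆H′ _ _ e) (Reach-map H⊆H′ p)

data Consecutive {A : Set} : List A → A → A → Set where
  here : ∀ {a b xs} → Consecutive (a ∷ b ∷ xs) a b
  there : ∀ {a xs u v} → Consecutive xs u v → Consecutive (a ∷ xs) u v

Walk : ∀ {n} → Graph n → List (Fin n) → Set
Walk H xs = ∀ {u v} → Consecutive xs u v → H u v ≡ true

module _ {A : Set} where

  Consecutive-∈ : ∀ {xs : List A} {u v} → Consecutive xs u v → u ∈ xs × v ∈ xs
  Consecutive-∈ here = here refl , there (here refl)
  Consecutive-∈ (there c) = let u∈ , v∈ = Consecutive-∈ c in there u∈ , there v∈

  Consecutive-++ˡ : ∀ {xs : List A} ys {u v} → Consecutive xs u v → Consecutive (xs ++ ys) u v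
  Consecutive-++ˡ ys here = here
  Consecutive-++ˡ ys (there c) = there (Consecutive-++ˡ ys c)

  Consecutive-++ʳ : ∀ (xs : List A) {ys u v} → Consecutive ys u v → Consecutive (xs ++ ys) u v
  Consecutive-++ʳ [] c = c
  Consecutive-++ʳ (x ∷ xs) c = there (Consecutive-++ʳ xs c)

  Consecutive-++⁻ : ∀ (xs : List A) {ys u v} → Consecutive (xs ++ ys) u v →
                    Consecutive xs u v ⊎ Consecutive ys u v ⊎
                    ((∃ λ zs → xs ≡ zs ++ u ∷ []) × (∃ λ ws → ys ≡ v ∷ ws))
  Consecutive-++⁻ [] c = inj₂ (inj₁ c)
  Consecutive-++⁻ (x ∷ []) {ys = _ ∷ ws} here = inj₂ (inj₂ (([] , refl) , (ws , refl)))
  Consecutive-++⁻ (x ∷ []) (there c) = inj₂ (inj₁ c)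
  Consecutive-++⁻ (x ∷ y ∷ xs) here = inj₁ here
  Consecutive-++⁻ (x ∷ y ∷ xs) (there c) with Consecutive-++⁻ (y ∷ xs) c
  ... | inj₁ c′ = inj₁ (there c′)
  ... | inj₂ (inj₁ c′) = inj₂ (inj₁ c′)
  ... | inj₂ (inj₂ ((zs , xs≡) , ys≡)) = inj₂ (inj₂ ((x ∷ zs , cong (x ∷_) xs≡) , ys≡))

  Consecutive-concat⁺ : ∀ {xss : List (List A)} {xs u v} → xs ∈ xss → Consecutive xs u v →
                        Consecutive (concat xss) u v
  Consecutive-concat⁺ {xs ∷ xss} (here refl) c = Consecutive-++ˡ (concat xss) c
  Consecutive-concat⁺ {ys ∷ xss} (there xs∈) c = Consecutive-++ʳ ys (Consecutive-concat⁺ xs∈ c)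

  Consecutive-≢ : ∀ {xs : List A} {u v} → Unique xs → Consecutive xs u v → ¬ u ≡ v
  Consecutive-≢ (u∉ ∷ _) here = All-lookup u∉ (here refl)
  Consecutive-≢ (_ ∷ uxs) (there c) = Consecutive-≢ uxs c

  Consecutive-lookup⁻ : ∀ {xs : List A} {u v} → Consecutive xs u v →
                        ∃ λ i → ∃ λ j → suc (toℕ i) ≡ toℕ j × lookup xs i ≡ u × lookup xs j ≡ v
  Consecutive-lookup⁻ here = zero , suc zero , refl , refl , refl
  Consecutive-lookup⁻ (there c) =
    let i , j , i+1≡j , xs[i] , xs[j] = Consecutive-lookup⁻ c in suc i , suc j , cong suc i+1≡j , xs[i] , xs[j]

  Consecutive-lookup⁺ : ∀ (xs : List A) i j → suc (toℕ i) ≡ toℕ j → Consecutive xs (lookup xs i) (lookup xs j)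
  Consecutive-lookup⁺ (a ∷ b ∷ xs) zero (suc zero) _ = here
  Consecutive-lookup⁺ (a ∷ xs) (suc i) (suc j) i+1≡j = there (Consecutive-lookup⁺ xs i j (suc-injective i+1≡j))

  Consecutive-tabulate⁻ : ∀ {m} (f : Fin m → A) {u v} → Consecutive (tabulate f) u v →
                          ∃ λ i → ∃ λ j → suc (toℕ i) ≡ toℕ j × f i ≡ u × f j ≡ v
  Consecutive-tabulate⁻ {suc (suc m)} f here = zero , suc zero , refl , refl , refl
  Consecutive-tabulate⁻ {suc m} f (there c) =
    let i , j , i+1≡j , fi , fj = Consecutive-tabulate⁻ (λ i → f (suc i)) c in suc i , suc j , cong suc i+1≡j , fi , fj

module _ {n : ℕ} {H : Graph n} where

  Walk-tabulate : ∀ {m} (f : Fin m → Fin n) → (∀ i j → suc (toℕ i) ≡ toℕ j → H (f i) (f j) ≡ true) →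
                  Walk H (tabulate f)
  Walk-tabulate f adj c with Consecutive-tabulate⁻ f c
  ... | i , j , i+1≡j , refl , refl = adj i j i+1≡j

  Walk-from-head : ∀ {a xs y} → Walk H (a ∷ xs) → y ∈ a ∷ xs → Reach H a y
  Walk-from-head walk (here refl) = here
  Walk-from-head {xs = b ∷ xs} walk (there y∈) = step (walk here) (Walk-from-head (walk ∘ there) y∈)

  Walk-Reach : Symmetric H → ∀ {xs x y} → Walk H xs → x ∈ xs → y ∈ xs → Reach H x y
  Walk-Reach H-sym {a ∷ xs} walk x∈ y∈ =
    Reach-trans (Reach-sym H-sym (Walk-from-head walk x∈)) (Walk-from-head walk y∈)

-- The path graph of vertex-disjoint lists

module _ {A : Set} where

  Unique-concat-piece : ∀ {xss : List (List A)} {xs} → Unique (concat xss) → xs ∈ xss → Unique xs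
  Unique-concat-piece {xs ∷ _} u (here refl) = proj₁ (Unique-++⁻ u)
  Unique-concat-piece {ys ∷ _} u (there xs∈) = Unique-concat-piece (proj₁ (proj₂ (Unique-++⁻ {xs = ys} u))) xs∈

  Unique-concat-same : ∀ {xss : List (List A)} {xs ys x} → Unique (concat xss) →
                       xs ∈ xss → ys ∈ xss → x ∈ xs → x ∈ ys → xs ≡ ys
  Unique-concat-same u (here refl) (here refl) _ _ = refl
  Unique-concat-same {xs ∷ _} u (here refl) (there ys∈) x∈xs x∈ys =
    ⊥-elim (proj₂ (proj₂ (Unique-++⁻ u)) (x∈xs , ∈-concat⁺′ x∈ys ys∈))
  Unique-concat-same {ys ∷ _} u (there xs∈) (here refl) x∈xs x∈ys =
    ⊥-elim (proj₂ (proj₂ (Unique-++⁻ u)) (x∈ys , ∈-concat⁺′ x∈xs xs∈))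
  Unique-concat-same {zs ∷ _} u (there xs∈) (there ys∈) =
    Unique-concat-same (proj₁ (proj₂ (Unique-++⁻ {xs = zs} u))) xs∈ ys∈

  links : List A → List (A × A)
  links (a ∷ b ∷ xs) = (a , b) ∷ (b , a) ∷ links (b ∷ xs)
  links _ = []

  links-∷ : ∀ {a xs e} → e ∈ links xs → e ∈ links (a ∷ xs)
  links-∷ {xs = _ ∷ _} e∈ = there (there e∈)

  ∈-links⁺ : ∀ {xs u v} → Consecutive xs u v → (u , v) ∈ links xs × (v , u) ∈ links xs
  ∈-links⁺ here = here refl , there (here refl)
  ∈-links⁺ (there c) = let uv , vu = ∈-links⁺ c in links-∷ uv , links-∷ vu

  ∈-links⁻ : ∀ xs {u v} → (u , v) ∈ links xs → Consecutive xs u v ⊎ Consecutive xs v u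
  ∈-links⁻ (a ∷ b ∷ xs) (here refl) = inj₁ here
  ∈-links⁻ (a ∷ b ∷ xs) (there (here refl)) = inj₂ here
  ∈-links⁻ (a ∷ b ∷ xs) (there (there e∈)) with ∈-links⁻ (b ∷ xs) e∈
  ... | inj₁ c = inj₁ (there c)
  ... | inj₂ c = inj₂ (there c)

  links-endpoint : ∀ xs {u v} → (u , v) ∈ links xs → u ∈ xs
  links-endpoint xs e∈ with ∈-links⁻ xs e∈
  ... | inj₁ c = proj₁ (Consecutive-∈ c)
  ... | inj₂ c = proj₂ (Consecutive-∈ c)

  Unique-links : ∀ {xs} → Unique xs → Unique (links xs)
  Unique-links {a ∷ b ∷ xs} u@(_ ∷ u′) =
    ¬Any⇒All¬ _ ab∉ ∷ ¬Any⇒All¬ _ ba∉ ∷ Unique-links u′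
    where
    a∉ : ¬ a ∈ b ∷ xs
    a∉ = Unique[x∷xs]⇒x∉xs u
    ab∉ : ¬ (a , b) ∈ (b , a) ∷ links (b ∷ xs)
    ab∉ (here ab≡ba) = a∉ (here (cong proj₁ ab≡ba))
    ab∉ (there ab∈) = a∉ (links-endpoint (b ∷ xs) ab∈)
    ba∉ : ¬ (b , a) ∈ links (b ∷ xs)
    ba∉ ba∈ with ∈-links⁻ (b ∷ xs) ba∈
    ... | inj₁ c = a∉ (proj₂ (Consecutive-∈ c))
    ... | inj₂ c = a∉ (proj₁ (Consecutive-∈ c))
  Unique-links {[]} _ = []
  Unique-links {_ ∷ []} _ = []

  Unique-concatMap-links : ∀ {xss : List (List A)} → Unique (concat xss) → Unique (concatMap links xss)
  Unique-concatMap-links {[]} _ = []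
  Unique-concatMap-links {xs ∷ xss} u =
    let uxs , uxss , disj = Unique-++⁻ {xs = xs} u in
    Uniqueₚ.++⁺ (Unique-links uxs) (Unique-concatMap-links {xss} uxss) λ (e∈ , e∈′) →
      let ys , e∈ys , ys∈ = ∈-concat⁻′ (map links xss) e∈′
          zs , zs∈ , ys≡ = ∈-map⁻ links ys∈
      in disj (links-endpoint xs e∈ , ∈-concat⁺′ (links-endpoint zs (subst (λ l → _ ∈ l) ys≡ e∈ys)) zs∈)

module _ {n : ℕ} where

  Ordered : Fin n × Fin n → Set
  Ordered (u , v) = toℕ u < toℕ v

  ordered? : Decidable Ordered
  ordered? (u , v) = toℕ u <? toℕ v

  length-filter-links : ∀ {xs : List (Fin n)} → Unique xs → length (filter ordered? (links xs)) ≡ length xs ∸ 1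
  length-filter-links {[]} _ = refl
  length-filter-links {_ ∷ []} _ = refl
  length-filter-links {a ∷ b ∷ xs} u@(_ ∷ u′) with toℕ a <? toℕ b | toℕ b <? toℕ a
  ... | yes a<b | yes b<a = ⊥-elim (<-asym a<b b<a)
  ... | yes a<b | no b≮a
    rewrite filter-accept ordered? {xs = (b , a) ∷ links (b ∷ xs)} a<b
          | filter-reject ordered? {xs = links (b ∷ xs)} b≮a =
    cong suc (length-filter-links u′)
  ... | no a≮b | yes b<a
    rewrite filter-reject ordered? {xs = (b , a) ∷ links (b ∷ xs)} a≮b
          | filter-accept ordered? {xs = links (b ∷ xs)} b<a =
    cong suc (length-filter-links u′)
  ... | no a≮b | no b≮a =
    ⊥-elim (Consecutive-≢ u here (toℕ-injective (≤-antisym (≮⇒≥ b≮a) (≮⇒≥ a≮b))))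

module PathsGraph {n : ℕ} (ps : List (List (Fin n))) (ps-disjoint : Unique (concat ps)) where

  open DecMembership (≡-dec (_≟_ {n}) (_≟_ {n})) using (_∈?_)

  allLinks : List (Fin n × Fin n)
  allLinks = concatMap links ps

  P : Graph n
  P u v = does ((u , v) ∈? allLinks)

  P-edge⁺ : ∀ {π u v} → π ∈ ps → Consecutive π u v → P u v ≡ true × P v u ≡ true
  P-edge⁺ {u = u} {v} π∈ c = let uv , vu = ∈-links⁺ c in
    dec-true ((u , v) ∈? allLinks) (∈-concat⁺′ uv (∈-map⁺ links π∈)) ,
    dec-true ((v , u) ∈? allLinks) (∈-concat⁺′ vu (∈-map⁺ links π∈))

  P-edge⁻ : ∀ {u v} → P u v ≡ true → ∃ λ π → π ∈ ps × (Consecutive π u v ⊎ Consecutive π v u)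
  P-edge⁻ {u} {v} e =
    let ls , uv∈ls , ls∈ = ∈-concat⁻′ (map links ps) (does⇒ ((u , v) ∈? allLinks) e)
        π , π∈ , ls≡ = ∈-map⁻ links ls∈
    in π , π∈ , ∈-links⁻ π (subst (λ l → _ ∈ l) ls≡ uv∈ls)

  P-sym : Symmetric P
  P-sym u v e with P-edge⁻ e
  ... | π , π∈ , inj₁ c = proj₂ (P-edge⁺ π∈ c)
  ... | π , π∈ , inj₂ c = proj₁ (P-edge⁺ π∈ c)

  P-closed : ∀ {π x y} → π ∈ ps → x ∈ π → P x y ≡ true → y ∈ π
  P-closed π∈ x∈ e with P-edge⁻ e
  ... | π′ , π′∈ , inj₁ c
    with refl ← Unique-concat-same ps-disjoint π∈ π′∈ x∈ (proj₁ (Consecutive-∈ c)) = proj₂ (Consecutive-∈ c)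
  ... | π′ , π′∈ , inj₂ c
    with refl ← Unique-concat-same ps-disjoint π∈ π′∈ x∈ (proj₂ (Consecutive-∈ c)) = proj₁ (Consecutive-∈ c)

  Reach-closed : ∀ {π x y} → π ∈ ps → x ∈ π → Reach P x y → y ∈ π
  Reach-closed π∈ x∈ here = x∈
  Reach-closed π∈ x∈ (step e p) = Reach-closed π∈ (P-closed π∈ x∈ e) p

  piece-path : ∀ {π v} → π ∈ ps → v ∈ π → ComponentIsPath P v (length π)
  piece-path {π} π∈ v∈ = lookup π , lookup-injective uπ ,
      (λ w → (λ v~w → ∈⇒lookup (Reach-closed π∈ v∈ v~w)) ,
             λ { (i , refl) → Walk-Reach P-sym (proj₁ ∘ P-edge⁺ π∈) v∈ (∈-lookup i) }) ,
      λ i j → adjacent⁻ i j , adjacent⁺ i j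
    where
    uπ : Unique π
    uπ = Unique-concat-piece ps-disjoint π∈
    position : ∀ {i j} → Consecutive π (lookup π i) (lookup π j) → suc (toℕ i) ≡ toℕ j
    position c with Consecutive-lookup⁻ c
    ... | i′ , j′ , i′+1≡j′ , πi′ , πj′
      rewrite lookup-injective uπ πi′ | lookup-injective uπ πj′ = i′+1≡j′
    adjacent⁻ : ∀ i j → P (lookup π i) (lookup π j) ≡ true → PathAdj i j
    adjacent⁻ i j e with P-edge⁻ e
    ... | π′ , π′∈ , inj₁ c
      with refl ← Unique-concat-same ps-disjoint π∈ π′∈ (∈-lookup i) (proj₁ (Consecutive-∈ c)) = inj₁ (position c)
    ... | π′ , π′∈ , inj₂ c
      with refl ← Unique-concat-same ps-disjoint π∈ π′∈ (∈-lookup i) (proj₂ (Consecutive-∈ c)) = inj₂ (position c)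
    adjacent⁺ : ∀ i j → PathAdj i j → P (lookup π i) (lookup π j) ≡ true
    adjacent⁺ i j (inj₁ i+1≡j) = proj₁ (P-edge⁺ π∈ (Consecutive-lookup⁺ π i j i+1≡j))
    adjacent⁺ i j (inj₂ j+1≡i) = proj₂ (P-edge⁺ π∈ (Consecutive-lookup⁺ π j i j+1≡i))

  edge-count : ∀ {qs : List (List (Fin n))} → Unique (concat qs) →
               length (filter ordered? (concatMap links qs)) ≡ sum (map (λ π → length π ∸ 1) qs)
  edge-count {[]} _ = refl
  edge-count {π ∷ qs} u = let uπ , uqs , _ = Unique-++⁻ {xs = π} u in begin
    length (filter ordered? (links π ++ concatMap links qs))
      ≡⟨ cong length (filter-++ ordered? (links π) (concatMap links qs)) ⟩
    length (filter ordered? (links π) ++ filter ordered? (concatMap links qs))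
      ≡⟨ length-++ (filter ordered? (links π)) ⟩
    length (filter ordered? (links π)) + length (filter ordered? (concatMap links qs))
      ≡⟨ cong₂ _+_ (length-filter-links uπ) (edge-count {qs} uqs) ⟩
    (length π ∸ 1) + sum (map (λ π → length π ∸ 1) qs) ∎
    where open ≡-Reasoning

  P-edges : NumEdges P (sum (map (λ π → length π ∸ 1) ps))
  P-edges = subst (NumEdges P) (edge-count {ps} ps-disjoint)
    (hasSize-fromList orderedLinks (Uniqueₚ.filter⁺ ordered? (Unique-concatMap-links {xss = ps} ps-disjoint))
      λ e → edge⇒∈ e , ∈⇒edge e)
    where
    orderedLinks : List (Fin n × Fin n)
    orderedLinks = filter ordered? allLinks
    edge⇒∈ : ∀ e → EdgeSet P e → e ∈ orderedLinks
    edge⇒∈ (u , v) (u<v , uv) = ∈-filter⁺ ordered? (does⇒ ((u , v) ∈? allLinks) uv) u<v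
    ∈⇒edge : ∀ e → e ∈ orderedLinks → EdgeSet P e
    ∈⇒edge (u , v) e∈ = let uv∈ , u<v = ∈-filter⁻ ordered? {xs = allLinks} e∈ in
      u<v , dec-true ((u , v) ∈? allLinks) uv∈

sum-pred-length : ∀ {A : Set} (πs : List (List A)) → All (λ π → 1 ≤ length π) πs →
                  sum (map (λ π → length π ∸ 1) πs) + length πs ≡ length (concat πs)
sum-pred-length [] [] = refl
sum-pred-length ((x ∷ t) ∷ πs) (_ ∷ nonempty) = begin
  (length t + S) + suc (length πs)    ≡⟨ +-suc (length t + S) (length πs) ⟩
  suc ((length t + S) + length πs)    ≡⟨ cong suc (+-assoc (length t) S (length πs)) ⟩
  suc (length t + (S + length πs))    ≡⟨ cong (λ l → suc (length t + l)) (sum-pred-length πs nonempty) ⟩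
  suc (length t + length (concat πs)) ≡⟨ cong suc (sym (length-++ t)) ⟩
  length ((x ∷ t) ++ concat πs)       ∎
  where
  open ≡-Reasoning
  S : ℕ
  S = sum (map (λ π → length π ∸ 1) πs)

-- Cutting lists into pieces of five to nine vertices

module _ {A : Set} where

  length-concat-≥ : ∀ {q} (πs : List (List A)) → All (λ π → q ≤ length π) πs →
                    q * length πs ≤ length (concat πs)
  length-concat-≥ {q} [] [] = ≤-reflexive (*-zeroʳ q)
  length-concat-≥ {q} (π ∷ πs) (q≤π ∷ bounds) = begin
    q * suc (length πs)                ≡⟨ *-suc q (length πs) ⟩
    q + q * length πs                  ≤⟨ +-mono-≤ q≤π (length-concat-≥ πs bounds) ⟩
    length π + length (concat πs)      ≡⟨ sym (length-++ π) ⟩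
    length (concat (π ∷ πs))           ∎
    where open ≤-Reasoning

  record Chunking (xs : List A) : Set where
    field
      pieces : List (List A)
      concat-pieces : concat pieces ≡ xs
      pieces-bounded : All (λ π → 1 ≤ length π × length π ≤ 9) pieces
      few-pieces : 5 * length pieces ≤ length xs + 4
      few-pieces-long : 5 ≤ length xs → 5 * length pieces ≤ length xs

  chunk-5-to-9 : ∀ xs → 5 ≤ length xs →
                 ∃ λ (πs : List (List A)) → concat πs ≡ xs × All (λ π → 5 ≤ length π × length π ≤ 9) πs
  chunk-5-to-9 (a ∷ b ∷ c ∷ d ∷ e ∷ ys) _ with 5 ≤? length ys
  ... | no ys≱5 =
    (a ∷ b ∷ c ∷ d ∷ e ∷ ys) ∷ [] , ++-identityʳ _ , (m≤m+n 5 (length ys) , +-monoʳ-≤ 5 (≮⇒≥ ys≱5)) ∷ []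
  ... | yes ys≥5 =
    let πs , concat≡ys , bounds = chunk-5-to-9 ys ys≥5 in
    (a ∷ b ∷ c ∷ d ∷ e ∷ []) ∷ πs , cong (λ t → a ∷ b ∷ c ∷ d ∷ e ∷ t) concat≡ys ,
    (≤-refl , m≤m+n 5 4) ∷ bounds
  chunk-5-to-9 (_ ∷ []) (s≤s ())
  chunk-5-to-9 (_ ∷ _ ∷ []) (s≤s (s≤s ()))
  chunk-5-to-9 (_ ∷ _ ∷ _ ∷ []) (s≤s (s≤s (s≤s ())))
  chunk-5-to-9 (_ ∷ _ ∷ _ ∷ _ ∷ []) (s≤s (s≤s (s≤s (s≤s ()))))

  chunking : ∀ xs → Chunking xs
  chunking xs with 5 ≤? length xs
  ... | yes xs≥5 = let πs , concat≡xs , bounds = chunk-5-to-9 xs xs≥5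
                       few = subst (5 * length πs ≤_) (cong length concat≡xs)
                                   (length-concat-≥ πs (All.map proj₁ bounds))
                   in record
    { pieces = πs
    ; concat-pieces = concat≡xs
    ; pieces-bounded = All.map (λ (lo , hi) → ≤-trans (s≤s z≤n) lo , hi) bounds
    ; few-pieces = ≤-trans few (m≤m+n (length xs) 4)
    ; few-pieces-long = λ _ → few
    }
  ... | no xs≱5 with xs
  ...   | [] = record
    { pieces = [] ; concat-pieces = refl ; pieces-bounded = [] ; few-pieces = z≤n ; few-pieces-long = λ () }
  ...   | x ∷ xs′ = record
    { pieces = (x ∷ xs′) ∷ []
    ; concat-pieces = ++-identityʳ _
    ; pieces-bounded = (s≤s z≤n , ≤-trans (≮⇒≥ xs≱5) (m≤m+n 4 5)) ∷ []
    ; few-pieces = +-monoˡ-≤ 4 (s≤s z≤n)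
    ; few-pieces-long = ⊥-elim ∘ xs≱5
    }

  chunkAll : List (List A) → List (List A)
  chunkAll = concatMap (Chunking.pieces ∘ chunking)

  concat-chunkAll : ∀ xss → concat (chunkAll xss) ≡ concat xss
  concat-chunkAll [] = refl
  concat-chunkAll (xs ∷ xss) = begin
    concat (pieces ++ chunkAll xss)           ≡⟨ sym (concat-++ pieces _) ⟩
    concat pieces ++ concat (chunkAll xss)    ≡⟨ cong₂ _++_ concat-pieces (concat-chunkAll xss) ⟩
    xs ++ concat xss                          ∎
    where
    open ≡-Reasoning
    open Chunking (chunking xs)

  chunkAll-∈ : ∀ xss {π} → π ∈ chunkAll xss → ∃ λ xs → xs ∈ xss × π ∈ Chunking.pieces (chunking xs)
  chunkAll-∈ (xs ∷ xss) π∈ with ∈-++⁻ (Chunking.pieces (chunking xs)) π∈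
  ... | inj₁ π∈xs = xs , here refl , π∈xs
  ... | inj₂ π∈xss = let ys , ys∈ , π∈ys = chunkAll-∈ xss π∈xss in ys , there ys∈ , π∈ys

  chunkAll-bounded : ∀ xss {π} → π ∈ chunkAll xss → 1 ≤ length π × length π ≤ 9
  chunkAll-bounded xss π∈ = let xs , _ , π∈xs = chunkAll-∈ xss π∈ in
    All-lookup (Chunking.pieces-bounded (chunking xs)) π∈xs

  chunkAll-count : ∀ {xss} → All (λ xs → 5 ≤ length xs) xss → 5 * length (chunkAll xss) ≤ length (concat xss)
  chunkAll-count {[]} [] = z≤n
  chunkAll-count {xs ∷ xss} (xs≥5 ∷ long) = begin
    5 * length (pieces ++ chunkAll xss)             ≡⟨ cong (5 *_) (length-++ pieces) ⟩
    5 * (length pieces + length (chunkAll xss))     ≡⟨ *-distribˡ-+ 5 (length pieces) _ ⟩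
    5 * length pieces + 5 * length (chunkAll xss)   ≤⟨ +-mono-≤ (few-pieces-long xs≥5) (chunkAll-count long) ⟩
    length xs + length (concat xss)                 ≡⟨ sym (length-++ xs) ⟩
    length (xs ++ concat xss)                       ∎
    where
    open ≤-Reasoning
    open Chunking (chunking xs)

  chunkAll-count-from : ∀ {xs xss s} → 5 * length (Chunking.pieces (chunking xs)) ≤ length xs + s →
                        All (λ ys → 5 ≤ length ys) xss →
                        5 * length (chunkAll (xs ∷ xss)) ≤ length (concat (xs ∷ xss)) + s
  chunkAll-count-from {xs} {xss} {s} first long = begin
    5 * length (pieces ++ chunkAll xss)               ≡⟨ cong (5 *_) (length-++ pieces) ⟩
    5 * (length pieces + length (chunkAll xss))       ≡⟨ *-distribˡ-+ 5 (length pieces) _ ⟩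
    5 * length pieces + 5 * length (chunkAll xss)     ≤⟨ +-mono-≤ first (chunkAll-count long) ⟩
    (length xs + s) + length (concat xss)             ≡⟨ xy∙z≈xz∙y (length xs) s _ ⟩
    (length xs + length (concat xss)) + s             ≡⟨ cong (_+ s) (sym (length-++ xs)) ⟩
    length (xs ++ concat xss) + s                     ∎
    where
    open ≤-Reasoning
    open Chunking (chunking xs)

four-fifths : ∀ {f δ N pc p} → f + δ ≤ N → 5 * pc ≤ N + 4 * δ → p + pc ≡ N → 4 * f ≤ 5 * p
four-fifths {f} {δ} {_} {pc} {p} f+δ≤N 5pc≤N+4δ refl = +-cancelʳ-≤ (5 * pc + 4 * δ) (4 * f) (5 * p) (begin
  4 * f + (5 * pc + 4 * δ)          ≡⟨ regroupˡ f δ pc ⟩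
  4 * (f + δ) + 5 * pc              ≤⟨ +-mono-≤ (*-monoʳ-≤ 4 f+δ≤N) 5pc≤N+4δ ⟩
  4 * (p + pc) + (p + pc + 4 * δ)   ≡⟨ regroupʳ p pc δ ⟩
  5 * p + (5 * pc + 4 * δ)          ∎)
  where
  open ≤-Reasoning
  regroupˡ : ∀ f δ pc → 4 * f + (5 * pc + 4 * δ) ≡ 4 * (f + δ) + 5 * pc
  regroupˡ = solve-∀
  regroupʳ : ∀ p pc δ → 4 * (p + pc) + (p + pc + 4 * δ) ≡ 5 * p + (5 * pc + 4 * δ)
  regroupʳ = solve-∀

Walk-pieces : ∀ {n} {H : Graph n} {xs πs π} → concat πs ≡ xs → Walk H xs → π ∈ πs → Walk H π
Walk-pieces refl walk π∈ c = walk (Consecutive-concat⁺ π∈ c)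

Walk-chunkAll : ∀ {n} {H : Graph n} {xss π} → All (Walk H) xss → π ∈ chunkAll xss → Walk H π
Walk-chunkAll {H = H} {xss} walks π∈ = let xs , xs∈ , π∈xs = chunkAll-∈ xss π∈ in
  Walk-pieces (Chunking.concat-pieces (chunking xs)) (All-lookup walks xs∈) π∈xs

module _ {A : Set} where

  rotate : ℕ → List A → List A
  rotate k xs = drop k xs ++ take k xs

  rotate-↭ : ∀ k (xs : List A) → rotate k xs ↭ xs
  rotate-↭ k xs = ↭-trans (++-comm (drop k xs) (take k xs)) (↭-reflexive (take++drop≡id k xs))

  Unique-rotate : ∀ k {xs : List A} → Unique xs → Unique (rotate k xs)
  Unique-rotate k {xs} = Unique-resp-↭ (setoid A) (↭⇒↭ₛ (↭-sym (rotate-↭ k xs)))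

  take-tabulate-last : ∀ {m} (f : Fin m → A) i → ∃ λ ys → take (suc (toℕ i)) (tabulate f) ≡ ys ++ f i ∷ []
  take-tabulate-last f zero = [] , refl
  take-tabulate-last f (suc i) = let ys , eq = take-tabulate-last (f ∘ suc) i in f zero ∷ ys , cong (f zero ∷_) eq

  drop-tabulate-head : ∀ {m} (f : Fin m → A) i → ∃ λ ys → drop (toℕ i) (tabulate f) ≡ f i ∷ ys
  drop-tabulate-head f zero = _ , refl
  drop-tabulate-head f (suc i) = drop-tabulate-head (f ∘ suc) i

  tabulate-last : ∀ {m} (f : Fin (suc m) → A) {ys u} → tabulate f ≡ ys ++ u ∷ [] → u ≡ f (fromℕ m)
  tabulate-last {zero} f {[]} refl = refl
  tabulate-last {zero} f {_ ∷ []} ()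
  tabulate-last {zero} f {_ ∷ _ ∷ _} ()
  tabulate-last {suc m} f {_ ∷ ys} eq = tabulate-last (f ∘ suc) (proj₂ (∷-injective eq))
  tabulate-last {suc m} f {[]} ()

module _ {n : ℕ} (H : Graph n) where

  record Traversal (y : Fin n) (xs : List (Fin n)) : Set where
    field
      unique : Unique xs
      walk : Walk H xs
      members : ∀ v → Iff (Reach H y v) (v ∈ xs)

  Traversal-hasSize : ∀ {y xs} → Traversal y xs → HasSize (Reach H y) (length xs)
  Traversal-hasSize t = hasSize-fromList _ unique members where open Traversal t

  tabulate-members : ∀ {y m} {f : Fin m → Fin n} → (∀ v → Iff (Reach H y v) (∃ λ i → f i ≡ v)) →
                     ∀ v → Iff (Reach H y v) (v ∈ tabulate f)
  tabulate-members {f = f} y⇔f v =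
    (λ y~v → let i , fi≡v = proj₁ (y⇔f v) y~v in subst (_∈ tabulate f) fi≡v (∈-tabulate⁺ i)) ,
    (λ v∈ → let i , v≡fi = ∈-tabulate⁻ v∈ in proj₂ (y⇔f v) (i , sym v≡fi))

  pathList : ∀ {y m} → ComponentIsPath H y m → List (Fin n)
  pathList (f , _) = tabulate f

  pathList-traversal : ∀ {y m} (pa : ComponentIsPath H y m) → Traversal y (pathList pa)
  pathList-traversal (f , f-inj , y⇔f , adj) = record
    { unique = Uniqueₚ.tabulate⁺ f-inj
    ; walk = Walk-tabulate f λ i j i+1≡j → proj₂ (adj i j) (inj₁ i+1≡j)
    ; members = tabulate-members y⇔f
    }

  cycleList : ∀ {y m} → ComponentIsCycle H y m → ℕ → List (Fin n)
  cycleList (_ , f , _) k = rotate k (tabulate f)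

  wrap-around : ∀ {m} (f : Fin m → Fin n) → (∀ i j → Iff (H (f i) (f j) ≡ true) (CycleAdj m i j)) →
                ∀ {u v ys} → tabulate f ≡ (v ∷ ys) ++ u ∷ [] → H u v ≡ true
  wrap-around {suc m} f adj {ys = ys} eq =
    subst₂ (λ a b → H a b ≡ true) (sym (tabulate-last f {ys = _ ∷ ys} eq)) (∷-injectiveˡ eq)
      (proj₂ (adj (fromℕ m) zero) (inj₂ (inj₂ (refl , cong suc (toℕ-fromℕ m)))))

  Walk-tabulate-cycle : ∀ {m} (f : Fin m → Fin n) → (∀ i j → Iff (H (f i) (f j) ≡ true) (CycleAdj m i j)) →
                        Walk H (tabulate f)
  Walk-tabulate-cycle f adj = Walk-tabulate f λ i j i+1≡j → proj₂ (adj i j) (inj₁ (inj₁ i+1≡j))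

  Walk-cycleList : ∀ {y m} (cy : ComponentIsCycle H y m) k → Walk H (cycleList cy k)
  Walk-cycleList (_ , f , _ , _ , adj) k c with Consecutive-++⁻ (drop k (tabulate f)) c
  ... | inj₁ c′ = Walk-tabulate-cycle f adj
    (subst (λ l → Consecutive l _ _) (take++drop≡id k (tabulate f)) (Consecutive-++ʳ _ c′))
  ... | inj₂ (inj₁ c′) = Walk-tabulate-cycle f adj
    (subst (λ l → Consecutive l _ _) (take++drop≡id k (tabulate f)) (Consecutive-++ˡ _ c′))
  ... | inj₂ (inj₂ ((zs , drop≡) , (ws , take≡))) = wrap-around f adj (begin
      tabulate f                                  ≡⟨ sym (take++drop≡id k (tabulate f)) ⟩
      take k (tabulate f) ++ drop k (tabulate f)  ≡⟨ cong₂ _++_ take≡ drop≡ ⟩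
      (_ ∷ ws) ++ zs ++ _ ∷ []                    ≡⟨ sym (++-assoc (_ ∷ ws) zs _) ⟩
      (_ ∷ ws ++ zs) ++ _ ∷ []                    ∎)
    where open ≡-Reasoning

  cycleList-traversal : ∀ {y m} (cy : ComponentIsCycle H y m) k → Traversal y (cycleList cy k)
  cycleList-traversal cy@(_ , f , f-inj , y⇔f , _) k = record
    { unique = Unique-rotate k (Uniqueₚ.tabulate⁺ f-inj)
    ; walk = Walk-cycleList cy k
    ; members = λ v → (λ y~v → ∈-resp-↭ (↭-sym (rotate-↭ k (tabulate f))) (proj₁ (tabulate-members y⇔f v) y~v))
                    , (λ v∈ → proj₂ (tabulate-members y⇔f v) (∈-resp-↭ (rotate-↭ k (tabulate f)) v∈))
    }

  cycleIndex : ∀ {y m} → ComponentIsCycle H y m → Fin m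
  cycleIndex (_ , _ , _ , y⇔f , _) = proj₁ (proj₁ (y⇔f _) here)

  cycleList-to : ∀ {y m} → ComponentIsCycle H y m → List (Fin n)
  cycleList-to cy = cycleList cy (suc (toℕ (cycleIndex cy)))

  cycleList-to-traversal : ∀ {y m} (cy : ComponentIsCycle H y m) → Traversal y (cycleList-to cy)
  cycleList-to-traversal cy = cycleList-traversal cy (suc (toℕ (cycleIndex cy)))

  cycleList-to-last : ∀ {y m} (cy : ComponentIsCycle H y m) → ∃ λ zs → cycleList-to cy ≡ zs ++ y ∷ []
  cycleList-to-last {y} cy@(_ , f , _ , y⇔f , _) =
    let i , fi≡y = proj₁ (y⇔f y) here
        zs , take≡ = take-tabulate-last f i
    in drop (suc (toℕ i)) (tabulate f) ++ zs ,
       trans (cong (drop (suc (toℕ i)) (tabulate f) ++_) (trans take≡ (cong (λ v → zs ++ v ∷ []) fi≡y)))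
             (sym (++-assoc (drop (suc (toℕ i)) (tabulate f)) zs (y ∷ [])))

  cycleList-from : ∀ {y m} (cy : ComponentIsCycle H y m) {p} → Reach H y p →
                   ∃ λ k → ∃ λ ys → cycleList cy k ≡ p ∷ ys
  cycleList-from (_ , f , _ , y⇔f , _) y~p =
    let i , fi≡p = proj₁ (y⇔f _) y~p
        ys , drop≡ = drop-tabulate-head f i
    in toℕ i , ys ++ take (toℕ i) (tabulate f) ,
       cong (_++ take (toℕ i) (tabulate f)) (trans drop≡ (cong (_∷ ys) fi≡p))

prevPath : ∀ {m} → Fin m → Fin m
prevPath zero = zero
prevPath (suc i) = inject₁ i

prevCycle : ∀ {m} → Fin m → Fin m
prevCycle {suc m} zero = fromℕ m
prevCycle (suc i) = inject₁ i

nextCycle : ∀ {m} → Fin m → Fin m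
nextCycle {suc m} i with suc (toℕ i) <? suc m
... | yes i+1<m = fromℕ< i+1<m
... | no _ = zero

inject₁-after : ∀ {m} {i : Fin (suc m)} {j : Fin m} → suc (toℕ i) ≡ toℕ (suc j) → inject₁ j ≡ i
inject₁-after {j = j} eq = toℕ-injective (trans (toℕ-inject₁ j) (sym (suc-injective eq)))

PathAdj-prev : ∀ {m} {i j : Fin m} → PathAdj i j → prevPath j ≡ i ⊎ prevPath i ≡ j
PathAdj-prev {j = suc j} (inj₁ eq) = inj₁ (inject₁-after eq)
PathAdj-prev {i = suc i} (inj₂ eq) = inj₂ (inject₁-after eq)

CycleAdj-prev : ∀ {m} {i j : Fin m} → CycleAdj m i j → prevCycle j ≡ i ⊎ prevCycle i ≡ j
CycleAdj-prev {j = suc j} (inj₁ (inj₁ eq)) = inj₁ (inject₁-after eq)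
CycleAdj-prev {i = suc i} (inj₁ (inj₂ eq)) = inj₂ (inject₁-after eq)
CycleAdj-prev {i = zero} {zero} (inj₁ (inj₁ ()))
CycleAdj-prev {i = zero} {zero} (inj₁ (inj₂ ()))
CycleAdj-prev {suc m} {zero} {j} (inj₂ (inj₁ (_ , j+1≡m))) =
  inj₂ (toℕ-injective (trans (toℕ-fromℕ m) (sym (suc-injective j+1≡m))))
CycleAdj-prev {suc m} {i} {zero} (inj₂ (inj₂ (_ , i+1≡m))) =
  inj₁ (toℕ-injective (trans (toℕ-fromℕ m) (sym (suc-injective i+1≡m))))

prevCycle-injective : ∀ {m} {i j : Fin m} → prevCycle i ≡ prevCycle j → i ≡ j
prevCycle-injective {i = zero} {zero} _ = refl
prevCycle-injective {suc m} {zero} {suc j} eq =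
  ⊥-elim (<-irrefl (sym (trans (sym (toℕ-fromℕ m)) (trans (cong toℕ eq) (toℕ-inject₁ j)))) (toℕ<n j))
prevCycle-injective {suc m} {suc i} {zero} eq =
  ⊥-elim (<-irrefl (sym (trans (sym (toℕ-fromℕ m)) (trans (cong toℕ (sym eq)) (toℕ-inject₁ i)))) (toℕ<n i))
prevCycle-injective {i = suc i} {suc j} eq =
  cong suc (toℕ-injective (trans (sym (toℕ-inject₁ i)) (trans (cong toℕ eq) (toℕ-inject₁ j))))

CycleAdj-prevCycle : ∀ {m} (i : Fin m) → CycleAdj m i (prevCycle i)
CycleAdj-prevCycle {suc m} zero = inj₂ (inj₁ (refl , cong suc (toℕ-fromℕ m)))
CycleAdj-prevCycle (suc i) = inj₁ (inj₂ (cong suc (toℕ-inject₁ i)))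

CycleAdj-nextCycle : ∀ {m} (i : Fin m) → CycleAdj m i (nextCycle i)
CycleAdj-nextCycle {suc m} i with suc (toℕ i) <? suc m
... | yes i+1<m = inj₁ (inj₁ (sym (toℕ-fromℕ< i+1<m)))
... | no i+1≮m = inj₂ (inj₂ (refl , ≤-antisym (toℕ<n i) (≮⇒≥ i+1≮m)))

prevCycle≢nextCycle : ∀ {m} → 3 ≤ m → (i : Fin m) → ¬ prevCycle i ≡ nextCycle i
prevCycle≢nextCycle {suc m} 3≤m zero eq with 1 <? suc m
... | yes 1<m with trans (sym (toℕ-fromℕ m)) (trans (cong toℕ eq) (toℕ-fromℕ< 1<m))
...   | refl with 3≤m
...     | s≤s (s≤s ())
prevCycle≢nextCycle {suc m} 3≤m zero eq | no 1≮m = 1≮m (≤-trans (s≤s (s≤s z≤n)) 3≤m)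
prevCycle≢nextCycle {suc m} 3≤m (suc i) eq with suc (suc (toℕ i)) <? suc m
... | yes i+2<m = n≢2+n (trans (sym (toℕ-inject₁ i)) (trans (cong toℕ eq) (toℕ-fromℕ< i+2<m)))
  where
  n≢2+n : ∀ {k} → ¬ k ≡ suc (suc k)
  n≢2+n {zero} ()
  n≢2+n {suc k} eq = n≢2+n (suc-injective eq)
... | no i+2≮m = i+2≮m (subst (λ t → suc (suc t) < suc m) (sym (trans (sym (toℕ-inject₁ i)) (cong toℕ eq))) 3≤m)

ComponentShape : ∀ {n} → Graph n → Fin n → Set
ComponentShape H x = (∃ λ m → ComponentIsPath H x m) ⊎ (∃ λ m → ComponentIsCycle H x m)

module _ {n : ℕ} {H : Graph n} where

  shape-enumeration : ∀ {x} → ComponentShape H x →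
    ∃ λ m → Σ (HasSize (Reach H x) m) λ (g , _) → ∀ i j → H (g i) (g j) ≡ true → CycleAdj m i j
  shape-enumeration (inj₁ (m , g , g-inj , x⇔g , adj)) = m , (g , g-inj , x⇔g) , λ i j e → inj₁ (proj₁ (adj i j) e)
  shape-enumeration (inj₂ (m , _ , g , g-inj , x⇔g , adj)) = m , (g , g-inj , x⇔g) , λ i j e → proj₁ (adj i j) e

  Reach-dec : ∀ {x} → ComponentShape H x → Decidable (Reach H x)
  Reach-dec shape = hasSize⇒dec (proj₁ (proj₂ (shape-enumeration shape)))

  ComponentIsCycle-size : ∀ {x m} → ComponentIsCycle H x m → HasSize (Reach H x) m
  ComponentIsCycle-size (_ , f , f-inj , x⇔f , _) = f , f-inj , x⇔f

  at-most-two-neighbours : ∀ {x} → ComponentShape H x → ∀ {y₁ y₂ y₃} →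
    H x y₁ ≡ true → H x y₂ ≡ true → H x y₃ ≡ true → y₁ ≡ y₂ ⊎ y₁ ≡ y₃ ⊎ y₂ ≡ y₃
  at-most-two-neighbours {x} shape e₁ e₂ e₃ with shape-enumeration shape
  ... | m , (g , g-inj , x⇔g) , adj =
    Sum.map (via (side e₁) (side e₂)) (Sum.map (via (side e₁) (side e₃)) (via (side e₂) (side e₃)))
      (pigeonhole (proj₂ (proj₂ (side e₁))) (proj₂ (proj₂ (side e₂))) (proj₂ (proj₂ (side e₃))))
    where
    i : Fin m
    i = proj₁ (proj₁ (x⇔g x) here)
    Side : Fin m → Set
    Side j = prevCycle j ≡ i ⊎ prevCycle i ≡ j
    side : ∀ {y} → H x y ≡ true → ∃ λ j → g j ≡ y × Side j
    side {y} e = let j , gj≡y = proj₁ (x⇔g y) (step e here) in j , gj≡y ,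
      CycleAdj-prev (adj i j (subst₂ (λ a b → H a b ≡ true) (sym (proj₂ (proj₁ (x⇔g x) here))) (sym gj≡y) e))
    pigeonhole : ∀ {a b c} → Side a → Side b → Side c → a ≡ b ⊎ a ≡ c ⊎ b ≡ c
    pigeonhole (inj₁ p) (inj₁ q) _ = inj₁ (prevCycle-injective (trans p (sym q)))
    pigeonhole (inj₂ p) (inj₂ q) _ = inj₁ (trans (sym p) q)
    pigeonhole (inj₁ p) (inj₂ _) (inj₁ r) = inj₂ (inj₁ (prevCycle-injective (trans p (sym r))))
    pigeonhole (inj₂ p) (inj₁ _) (inj₂ r) = inj₂ (inj₁ (trans (sym p) r))
    pigeonhole (inj₁ _) (inj₂ q) (inj₂ r) = inj₂ (inj₂ (trans (sym q) r))
    pigeonhole (inj₂ _) (inj₁ q) (inj₁ r) = inj₂ (inj₂ (prevCycle-injective (trans q (sym r))))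
    via : ∀ {y y′} (a : ∃ λ j → g j ≡ y × Side j) (b : ∃ λ j → g j ≡ y′ × Side j) →
          proj₁ a ≡ proj₁ b → y ≡ y′
    via (_ , refl , _) (_ , refl , _) refl = refl

  path≢cycle : ∀ {x m m′} → ComponentIsPath H x m → ComponentIsCycle H x m′ → ⊥
  path≢cycle {x} {zero} (f , _ , x⇔f , _) _ with proj₁ (x⇔f x) here
  ... | () , _
  path≢cycle {x} {suc m} {m′} (f , f-inj , x⇔f , adjf) (3≤m′ , g , g-inj , x⇔g , adjg) =
    let a₁ , a₁≡1 , fa₁≡ = beside (CycleAdj-prevCycle i)
        a₂ , a₂≡1 , fa₂≡ = beside (CycleAdj-nextCycle i)
    in prevCycle≢nextCycle 3≤m′ i
         (g-inj (trans (sym fa₁≡) (trans (cong f (toℕ-injective (trans a₁≡1 (sym a₂≡1)))) fa₂≡)))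
    where
    start∈ : Reach H x (f zero)
    start∈ = proj₂ (x⇔f (f zero)) (zero , refl)
    i : Fin m′
    i = proj₁ (proj₁ (x⇔g (f zero)) start∈)
    gi≡start : g i ≡ f zero
    gi≡start = proj₂ (proj₁ (x⇔g (f zero)) start∈)
    second : ∀ {a} → PathAdj {suc m} zero a → toℕ a ≡ 1
    second (inj₁ 1≡a) = sym 1≡a
    beside : ∀ {j} → CycleAdj m′ i j → ∃ λ a → toℕ a ≡ 1 × f a ≡ g j
    beside {j} adj =
      let start-gj = subst (λ u → H u (g j) ≡ true) gi≡start (proj₂ (adjg i j) adj)
          a , fa≡gj = proj₁ (x⇔f (g j)) (Reach-trans start∈ (step start-gj here))
      in a , second (proj₁ (adjf zero a) (subst (λ v → H (f zero) v ≡ true) (sym fa≡gj) start-gj)) , fa≡gj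

-- A path–cycle cover has at most as many edges as vertices

-- Each edge {u, v} is {h, pred h} for its head h, so distinct edges have distinct heads.  pred follows one
-- fixed enumeration per component, that of its least vertex root, and the first vertex of a path is its
-- own predecessor, hence never a head.
module Orientation {n : ℕ} (H : Graph n) (H-sym : Symmetric H) (shape : ∀ x → ComponentShape H x) where

  reach? : ∀ x → Decidable (Reach H x)
  reach? x = Reach-dec (shape x)

  members : Fin n → List (Fin n)
  members x = filter (reach? x) (allFin n)

  members-cong : ∀ {x y} → Reach H x y → members x ≡ members y
  members-cong x~y = filter-≐ (reach? _) (reach? _)
    (Reach-trans (Reach-sym H-sym x~y) , Reach-trans x~y) (allFin n)

  root : Fin n → Fin n
  root x with members x
  ... | [] = x
  ... | r ∷ _ = r

  root-reach : ∀ x → Reach H x (root x)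
  root-reach x with members x | all-filter (reach? x) (allFin n)
  ... | [] | _ = here
  ... | _ ∷ _ | x~r ∷ _ = x~r

  root-cong : ∀ {x y} → Reach H x y → root x ≡ root y
  root-cong {x} {y} x~y with members x | members y | members-cong x~y | ∈-filter⁺ (reach? y) (∈-allFin y) here
  ... | _ ∷ _ | _ ∷ _ | refl | _ = refl

  before : ∀ {m} → (Fin m → Fin m) → (Fin m → Fin n) → Fin n → Fin n
  before prev f u with any? (λ i → f i ≟ u)
  ... | yes (i , _) = f (prev i)
  ... | no _ = u

  before-at : ∀ {m} (prev : Fin m → Fin m) {f : Fin m → Fin n} → Injective _≡_ _≡_ f →
              ∀ {i u} → f i ≡ u → before prev f u ≡ f (prev i)
  before-at prev {f} f-inj {i} {u} fi≡u with any? (λ i → f i ≟ u)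
  ... | yes (i′ , fi′≡u) = cong (f ∘ prev) (f-inj (trans fi′≡u (sym fi≡u)))
  ... | no ∄i = ⊥-elim (∄i (i , fi≡u))

  predIn : ∀ {r} → ComponentShape H r → Fin n → Fin n
  predIn (inj₁ (_ , f , _)) = before prevPath f
  predIn (inj₂ (_ , _ , f , _)) = before prevCycle f

  pred : Fin n → Fin n
  pred u = predIn (shape (root u)) u

  pred-root : ∀ {u r} → root u ≡ r → pred u ≡ predIn (shape r) u
  pred-root refl = refl

  predIn-edge : ∀ {r u v} (s : ComponentShape H r) → Reach H r u → H u v ≡ true →
                predIn s u ≡ v ⊎ predIn s v ≡ u
  predIn-edge {r} {u} {v} (inj₁ (_ , f , f-inj , r⇔f , adj)) r~u e
    with proj₁ (r⇔f u) r~u | proj₁ (r⇔f v) (Reach-trans r~u (step e here))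
  ... | i , refl | j , refl with PathAdj-prev (proj₁ (adj i j) e)
  ...   | inj₁ prev-j≡i = inj₂ (trans (before-at prevPath f-inj refl) (cong f prev-j≡i))
  ...   | inj₂ prev-i≡j = inj₁ (trans (before-at prevPath f-inj refl) (cong f prev-i≡j))
  predIn-edge {r} {u} {v} (inj₂ (_ , _ , f , f-inj , r⇔f , adj)) r~u e
    with proj₁ (r⇔f u) r~u | proj₁ (r⇔f v) (Reach-trans r~u (step e here))
  ... | i , refl | j , refl with CycleAdj-prev (proj₁ (adj i j) e)
  ...   | inj₁ prev-j≡i = inj₂ (trans (before-at prevCycle f-inj refl) (cong f prev-j≡i))
  ...   | inj₂ prev-i≡j = inj₁ (trans (before-at prevCycle f-inj refl) (cong f prev-i≡j))

  pred-edge : ∀ {u v} → H u v ≡ true → pred u ≡ v ⊎ pred v ≡ u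
  pred-edge {u} {v} e =
    Sum.map₂ (trans (pred-root (sym (root-cong (step e here)))))
      (predIn-edge (shape (root u)) (Reach-sym H-sym (root-reach u)) e)

  pred-path-start : ∀ {c m} → ComponentIsPath H c m → ∃ λ s → Reach H c s × pred s ≡ s
  pred-path-start {c} pa = start (shape (root c)) refl (ComponentIsPath-reroot H-sym (root-reach c) pa)
    where
    open ≡-Reasoning
    start : ∀ {m} (s : ComponentShape H (root c)) → shape (root c) ≡ s → ComponentIsPath H (root c) m →
            ∃ λ s → Reach H c s × pred s ≡ s
    start (inj₂ (_ , cy)) _ pa′ = ⊥-elim (path≢cycle pa′ cy)
    start (inj₁ (zero , f , _ , r⇔f , _)) _ _ with proj₁ (r⇔f (root c)) here
    ... | () , _
    start (inj₁ (suc m , f , f-inj , r⇔f , _)) shape≡ _ = f zero , Reach-trans (root-reach c) start∈ , (begin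
      pred (f zero)                       ≡⟨ pred-root (sym (root-cong (Reach-trans (root-reach c) start∈))) ⟩
      predIn (shape (root c)) (f zero)    ≡⟨ cong (λ s → predIn s (f zero)) shape≡ ⟩
      before prevPath f (f zero)          ≡⟨ before-at prevPath f-inj refl ⟩
      f zero                              ∎)
      where
      start∈ : Reach H (root c) (f zero)
      start∈ = proj₂ (r⇔f (f zero)) (zero , refl)

  head : Fin n × Fin n → Fin n
  head (u , v) with pred u ≟ v
  ... | yes _ = u
  ... | no _ = v

  head-spec : ∀ {u v} → H u v ≡ true → (head (u , v) ≡ u × pred u ≡ v) ⊎ (head (u , v) ≡ v × pred v ≡ u)
  head-spec {u} {v} e with pred u ≟ v
  ... | yes pred-u≡v = inj₁ (refl , pred-u≡v)
  ... | no pred-u≢v = inj₂ (refl , Sum.[ (λ p → ⊥-elim (pred-u≢v p)) , (λ p → p) ] (pred-edge e))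

  head-injective : ∀ {u₁ v₁ u₂ v₂} → toℕ u₁ < toℕ v₁ → H u₁ v₁ ≡ true →
                   toℕ u₂ < toℕ v₂ → H u₂ v₂ ≡ true →
                   head (u₁ , v₁) ≡ head (u₂ , v₂) → (u₁ , v₁) ≡ (u₂ , v₂)
  head-injective u₁<v₁ e₁ u₂<v₂ e₂ eq with head-spec e₁ | head-spec e₂
  ... | inj₁ (h₁ , p₁) | inj₁ (h₂ , p₂) =
    let u₁≡u₂ = trans (sym h₁) (trans eq h₂) in
    cong₂ _,_ u₁≡u₂ (trans (sym p₁) (trans (cong pred u₁≡u₂) p₂))
  ... | inj₂ (h₁ , p₁) | inj₂ (h₂ , p₂) =
    let v₁≡v₂ = trans (sym h₁) (trans eq h₂) in
    cong₂ _,_ (trans (sym p₁) (trans (cong pred v₁≡v₂) p₂)) v₁≡v₂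
  ... | inj₁ (h₁ , p₁) | inj₂ (h₂ , p₂) =
    let u₁≡v₂ = trans (sym h₁) (trans eq h₂) ; v₁≡u₂ = trans (sym p₁) (trans (cong pred u₁≡v₂) p₂) in
    ⊥-elim (<-asym u₁<v₁ (subst₂ (λ a b → toℕ a < toℕ b) (sym v₁≡u₂) (sym u₁≡v₂) u₂<v₂))
  ... | inj₂ (h₁ , p₁) | inj₁ (h₂ , p₂) =
    let v₁≡u₂ = trans (sym h₁) (trans eq h₂) ; u₁≡v₂ = trans (sym p₁) (trans (cong pred v₁≡u₂) p₂) in
    ⊥-elim (<-asym u₁<v₁ (subst₂ (λ a b → toℕ a < toℕ b) (sym v₁≡u₂) (sym u₁≡v₂) u₂<v₂))

  EdgesWithin : (Fin n → Set) → Fin n × Fin n → Set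
  EdgesWithin K (u , v) = toℕ u < toℕ v × H u v ≡ true × K u

  module _ {K : Fin n → Set} (K-closed : ∀ {u v} → K u → H u v ≡ true → K v) {N f : ℕ}
           (K-size : HasSize K N) (E-size : HasSize (EdgesWithin K) f) where

    head-within : ∀ e → EdgesWithin K e → K (head e)
    head-within (u , v) (_ , e , Ku) with head-spec e
    ... | inj₁ (head≡u , _) = subst K (sym head≡u) Ku
    ... | inj₂ (head≡v , _) = subst K (sym head≡v) (K-closed Ku e)

    head-injective-within : ∀ e₁ e₂ → EdgesWithin K e₁ → EdgesWithin K e₂ →
                            head e₁ ≡ head e₂ → e₁ ≡ e₂
    head-injective-within _ _ (u₁<v₁ , e₁ , _) (u₂<v₂ , e₂ , _) = head-injective u₁<v₁ e₁ u₂<v₂ e₂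

    edges≤vertices : f ≤ N
    edges≤vertices = hasSize-≤-injection E-size K-size head head-within head-injective-within

    edges<vertices : ∀ {c m} → K c → ComponentIsPath H c m → suc f ≤ N
    edges<vertices Kc pa with pred-path-start pa
    ... | s , c~s , pred-s≡s = hasSize-<-injection E-size K-size head head-within head-injective-within
      s (Reach-closed Kc c~s) λ { (u , v) (u<v , e , _) head≡s → head-misses u<v e head≡s }
      where
      Reach-closed : ∀ {x y} → K x → Reach H x y → K y
      Reach-closed Kx here = Kx
      Reach-closed Kx (step e p) = Reach-closed (K-closed Kx e) p
      head-misses : ∀ {u v} → toℕ u < toℕ v → H u v ≡ true → ¬ head (u , v) ≡ s
      head-misses u<v e head≡s with head-spec e
      ... | inj₁ (h , p) = let u≡s = trans (sym h) head≡s in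
        <-irrefl (cong toℕ (sym (trans (sym p) (trans (cong pred u≡s) (trans pred-s≡s (sym u≡s)))))) u<v
      ... | inj₂ (h , p) = let v≡s = trans (sym h) head≡s in
        <-irrefl (cong toℕ (trans (sym p) (trans (cong pred v≡s) (trans pred-s≡s (sym v≡s))))) u<v

-- Cutting the centre at its anchors

-- split xs = (the elements before the first anchor, and for each anchor x the block leaf x ++ x ∷ s,
-- where s are the non-anchors following x in xs).
module Blocks {A : Set} (isAnchor : A → Bool) (leaf : A → List A) where

  expandWith : Bool → A → List A
  expandWith true x = leaf x ++ x ∷ []
  expandWith false x = x ∷ []

  expand : A → List A
  expand x = expandWith (isAnchor x) x

  consume : Bool → A → List A × List (List A) → List A × List (List A)
  consume true x (pre , bs) = [] , (leaf x ++ x ∷ pre) ∷ bs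
  consume false x (pre , bs) = x ∷ pre , bs

  split : List A → List A × List (List A)
  split [] = [] , []
  split (x ∷ xs) = consume (isAnchor x) x (split xs)

  flatten : List A × List (List A) → List A
  flatten (pre , bs) = pre ++ concat bs

  consume-flatten : ∀ b x g → flatten (consume b x g) ≡ expandWith b x ++ flatten g
  consume-flatten true x (pre , bs) =
    trans (++-assoc (leaf x) (x ∷ pre) (concat bs)) (sym (++-assoc (leaf x) (x ∷ []) (pre ++ concat bs)))
  consume-flatten false x (pre , bs) = refl

  split-flatten : ∀ xs → flatten (split xs) ≡ concatMap expand xs
  split-flatten [] = refl
  split-flatten (x ∷ xs) = trans (consume-flatten (isAnchor x) x (split xs)) (cong (expand x ++_) (split-flatten xs))

  split-prefix : ∀ xs → ∃ λ t → xs ≡ proj₁ (split xs) ++ t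
  split-prefix [] = [] , refl
  split-prefix (x ∷ xs) with isAnchor x | split-prefix xs
  ... | true | _ = x ∷ xs , refl
  ... | false | t , xs≡ = t , cong (x ∷_) xs≡

  split-from-anchor : ∀ {x} xs → isAnchor x ≡ true → proj₁ (split (x ∷ xs)) ≡ []
  split-from-anchor xs x-anchor rewrite x-anchor = refl

  record Block (xs b : List A) : Set where
    field
      anchor : A
      anchor∈ : anchor ∈ xs
      is-anchor : isAnchor anchor ≡ true
      segment : List A
      block≡ : b ≡ leaf anchor ++ anchor ∷ segment
      segment-consecutive : ∀ {u v} → Consecutive (anchor ∷ segment) u v → Consecutive xs u v

  Block-∷ : ∀ {x xs b} → Block xs b → Block (x ∷ xs) b
  Block-∷ blk = record
    { anchor = anchor ; anchor∈ = there anchor∈ ; is-anchor = is-anchor ; segment = segment ; block≡ = block≡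
    ; segment-consecutive = there ∘ segment-consecutive }
    where open Block blk

  split-blocks : ∀ xs {b} → b ∈ proj₂ (split xs) → Block xs b
  split-blocks (x ∷ xs) b∈ with isAnchor x in x-anchor
  split-blocks (x ∷ xs) (here refl) | true = let t , xs≡ = split-prefix xs in record
    { anchor = x
    ; anchor∈ = here refl
    ; is-anchor = x-anchor
    ; segment = proj₁ (split xs)
    ; block≡ = refl
    ; segment-consecutive = λ c → subst (λ l → Consecutive (x ∷ l) _ _) (sym xs≡) (Consecutive-++ˡ t c)
    }
  split-blocks (x ∷ xs) (there b∈) | true = Block-∷ (split-blocks xs b∈)
  split-blocks (x ∷ xs) b∈ | false = Block-∷ (split-blocks xs b∈)

-- Stingy covers and the component K

∧-⌊≟⌋-false : ∀ {n} {x x′ y y′ : Fin n} → ¬ (x ≡ x′ × y ≡ y′) →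
              (⌊ x ≟ x′ ⌋ ∧ ⌊ y ≟ y′ ⌋) ≡ false
∧-⌊≟⌋-false {x = x} {x′} {y} {y′} ¬eq with x ≟ x′ | y ≟ y′
... | yes p | yes q = ⊥-elim (¬eq (p , q))
... | yes _ | no _ = refl
... | no _ | _ = refl

module StingyCover {n : ℕ} (G F W : Graph n) (F-cover : PathCycleCover ⟦ G ⟧ F) (W-optimal : OptimalW G F W) where

  F-sym : Symmetric F
  F-sym = proj₁ (proj₁ F-cover)

  F-shape : ∀ x → ComponentShape F x
  F-shape = proj₂ F-cover

  W-sym : Symmetric W
  W-sym = proj₁ (proj₁ (proj₁ W-optimal))

  W-shape : ∀ x → ComponentShape W x
  W-shape = proj₂ (proj₁ W-optimal)

  W-separates : ∀ {u v} → W u v ≡ true → ¬ Reach F u v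
  W-separates e = proj₁ (proj₂ (proj₂ (proj₁ (proj₁ W-optimal)) _ _ e))

  F-reach? : ∀ x → Decidable (Reach F x)
  F-reach? x = Reach-dec (F-shape x)

  cycle4? : ∀ x → Dec (ComponentIsCycle F x 4)
  cycle4? x with F-shape x
  ... | inj₁ (_ , pa) = no (path≢cycle pa)
  ... | inj₂ (m , cy) with m ℕ.≟ 4
  ...   | yes refl = yes cy
  ...   | no m≢4 = no λ cy₄ →
    m≢4 (hasSize-cong (ComponentIsCycle-size cy) (ComponentIsCycle-size cy₄) λ _ → Iff-refl)

  weight : ∀ E′ → ∃ (Weight F E′)
  weight E′ = hasSize-decidable (allFin n) (Uniqueₚ.allFin⁺ n) ∈-allFin λ v →
    cycle4? v ×-dec all? (λ u → F-reach? v u →-dec (v Finₚ.≤? u)) ×-dec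
    any? (λ u → any? λ w → F-reach? v u ×-dec (E′ u w Bool.≟ true))

  removeEdge-⊆ : ∀ {a b u v} → removeEdge W a b u v ≡ true → W u v ≡ true
  removeEdge-⊆ {u = u} {v} e with W u v
  ... | true = refl

  removeEdge-keeps : ∀ {a b u v} → W u v ≡ true → ¬ (u ≡ a × v ≡ b) → ¬ (u ≡ b × v ≡ a) →
                     removeEdge W a b u v ≡ true
  removeEdge-keeps e ¬ab ¬ba rewrite e | ∧-⌊≟⌋-false ¬ab | ∧-⌊≟⌋-false ¬ba = refl

  Counted : Graph n → Fin n → Set
  Counted E′ v = ComponentIsCycle F v 4 × (∀ u → Reach F v u → v ≤ᶠ u) × Saturates F E′ v

  removal-unsaturates : ∀ {a b} → W a b ≡ true →
    ¬ (∀ v → ComponentIsCycle F v 4 → Saturates F W v → Saturates F (removeEdge W a b) v)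
  removal-unsaturates {a} {b} e keeps with weight (removeEdge W a b) | weight W
  ... | c , Wc | d , Wd = <-irrefl (hasSize-cong Wc Wd same) (proj₂ (proj₂ W-optimal) a b e c d Wc Wd)
    where
    same : ∀ v → Iff (Counted (removeEdge W a b) v) (Counted W v)
    same v = (λ (cy , least , u , w , v~u , e′) → cy , least , u , w , v~u , removeEdge-⊆ e′)
           , (λ (cy , least , sat) → cy , least , keeps v cy sat)

  Lonely : Fin n → Fin n → Set
  Lonely x y = ComponentIsCycle F x 4 × (∀ p q → Reach F x p → W p q ≡ true → p ≡ x × q ≡ y)

  Spare : Fin n → Fin n → Set
  Spare x y = ∃ λ p → ∃ λ q → Reach F x p × W p q ≡ true × ¬ (p ≡ x × q ≡ y)

  lonely-or-spare : ∀ x y → Lonely x y ⊎ (ComponentIsCycle F x 4 → Spare x y)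
  lonely-or-spare x y with cycle4? x
  ... | no ¬cy = inj₂ (⊥-elim ∘ ¬cy)
  ... | yes cy
    with any? (λ p → any? λ q → F-reach? x p ×-dec (W p q Bool.≟ true) ×-dec ¬? ((p ≟ x) ×-dec (q ≟ y)))
  ...   | yes spare = inj₂ (λ _ → spare)
  ...   | no ∄spare = inj₁ (cy , λ p q x~p e →
    decidable-stable ((p ≟ x) ×-dec (q ≟ y)) λ ¬xy → ∄spare (p , q , x~p , e , ¬xy))

  spare-survives : ∀ {x y v} → W x y ≡ true → Reach F v x → Spare x y →
                   Saturates F (removeEdge W x y) v × Saturates F (removeEdge W y x) v
  spare-survives e v~x (p , q , x~p , e′ , ¬xy) = (p , q , Reach-trans v~x x~p , removeEdge-keeps e′ ¬xy ¬yx)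
                                                 , (p , q , Reach-trans v~x x~p , removeEdge-keeps e′ ¬yx ¬xy)
    where
    ¬yx : ¬ (p ≡ _ × q ≡ _)
    ¬yx (refl , _) = W-separates e x~p

  saturation-survives : ∀ {x y} → W x y ≡ true → (ComponentIsCycle F x 4 → Spare x y) →
    (ComponentIsCycle F y 4 → Spare y x) →
    ∀ v → ComponentIsCycle F v 4 → Saturates F W v → Saturates F (removeEdge W x y) v
  saturation-survives {x} {y} e spare-x spare-y v cy (u , w , v~u , e′)
    with (u ≟ x) ×-dec (w ≟ y) | (u ≟ y) ×-dec (w ≟ x)
  ... | yes (refl , refl) | _ = proj₁ (spare-survives e v~u (spare-x (ComponentIsCycle-reroot F-sym v~u cy)))
  ... | no _ | yes (refl , refl) = proj₂ (spare-survives (W-sym _ _ e) v~u (spare-y (ComponentIsCycle-reroot F-sym v~u cy)))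
  ... | no ¬xy | no ¬yx = u , w , v~u , removeEdge-keeps e′ ¬xy ¬yx

  -- Otherwise deleting x y would leave every saturated 4-cycle saturated, so W would not be stingy.
  stingy-lonely : ∀ {x y} → W x y ≡ true → Lonely x y ⊎ Lonely y x
  stingy-lonely {x} {y} e with lonely-or-spare x y | lonely-or-spare y x
  ... | inj₁ lonely | _ = inj₁ lonely
  ... | inj₂ _ | inj₁ lonely = inj₂ lonely
  ... | inj₂ spare-x | inj₂ spare-y = ⊥-elim (removal-unsaturates e (saturation-survives e spare-x spare-y))

  ⊕-sym : Symmetric (F ⊕ W)
  ⊕-sym u v e = Sum.[ (λ f → ∨-introˡ (F-sym u v f)) , (λ w → ∨-introʳ {F v u} (W-sym u v w)) ] (∨-elim e)

  module Centre (r c : Fin n) (c-centre : IsCenter F W r c) (no-2-anchor : NoTwoAnchor F W c) where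

    K : Fin n → Set
    K = InK F W r

    K-F : ∀ {u v} → K u → Reach F u v → K v
    K-F Ku u~v = Reach-trans Ku (Reach-map (λ _ _ → ∨-introˡ) u~v)

    K-W : ∀ {u v} → K u → W u v ≡ true → K v
    K-W {u} Ku e = Reach-trans Ku (step (∨-introʳ {F u _} e) here)

    C⊆K : ∀ {v} → Reach F c v → K v
    C⊆K = K-F (proj₁ c-centre)

    W-neighbour-unique : ∀ {x y₁ y₂} → Reach F c x → W x y₁ ≡ true → W x y₂ ≡ true → y₁ ≡ y₂
    W-neighbour-unique {x} {y₁} {y₂} c~x e₁ e₂ with y₁ ≟ y₂
    ... | yes y₁≡y₂ = y₁≡y₂
    ... | no y₁≢y₂ = ⊥-elim (no-2-anchor x c~x (pair , pair-injective , neighbours))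
      where
      pair : Fin 2 → Fin n
      pair zero = y₁
      pair (suc _) = y₂
      pair-injective : Injective _≡_ _≡_ pair
      pair-injective {zero} {zero} _ = refl
      pair-injective {zero} {suc zero} eq = ⊥-elim (y₁≢y₂ eq)
      pair-injective {suc zero} {zero} eq = ⊥-elim (y₁≢y₂ (sym eq))
      pair-injective {suc zero} {suc zero} _ = refl
      neighbours : ∀ u → Iff (W x u ≡ true) (∃ λ i → pair i ≡ u)
      neighbours u =
        (λ e → Sum.[ ⊥-elim ∘ y₁≢y₂ , Sum.[ (λ y₁≡u → zero , y₁≡u) , (λ y₂≡u → suc zero , y₂≡u) ] ]
                 (at-most-two-neighbours (W-shape x) e₁ e₂ e)) ,
        λ { (zero , refl) → e₁ ; (suc zero , refl) → e₂ }

    -- A star centre has two W-edges leaving C, and in the edge case every W-edge at the other component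
    -- returns to C.
    sole-exit-lonely : ∀ {x y} → Reach F c x → W x y ≡ true →
                       (∀ {p q} → Reach F c p → W p q ≡ true → p ≡ x × q ≡ y) → Lonely y x
    sole-exit-lonely {x} {y} c~x e only with proj₂ c-centre
    ... | inj₁ (_ , _ , _ , _ , (_ , _ , _ , c~u₁ , x₁~v₁ , e₁) , (_ , _ , _ , c~u₂ , x₂~v₂ , e₂) , x₁≁x₂) =
      ⊥-elim (x₁≁x₂ (Reach-trans (subst (Reach F _) (proj₂ (only c~u₁ e₁)) x₁~v₁)
                                 (Reach-sym F-sym (subst (Reach F _) (proj₂ (only c~u₂ e₂)) x₂~v₂))))
    ... | inj₂ (d , _ , _ , cover , d-cycle) = ComponentIsCycle-reroot F-sym d~y d-cycle , y-only
      where
      Ky : K y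
      Ky = K-W (C⊆K c~x) e
      d~y : Reach F d y
      d~y = Sum.[ (λ c~y → ⊥-elim (W-separates e (Reach-trans (Reach-sym F-sym c~x) c~y))) , (λ d~y → d~y) ]
              (cover y Ky)
      y-only : ∀ p q → Reach F y p → W p q ≡ true → p ≡ y × q ≡ x
      y-only p q y~p e′ with cover q (K-W (K-F Ky y~p) e′)
      ... | inj₁ c~q = let q≡x , p≡y = only c~q (W-sym p q e′) in p≡y , q≡x
      ... | inj₂ d~q = ⊥-elim (W-separates e′ (Reach-trans (Reach-sym F-sym y~p) (Reach-trans (Reach-sym F-sym d~y) d~q)))

    leaf-lonely : ∀ {x y} → Reach F c x → W x y ≡ true → Lonely y x
    leaf-lonely c~x e with stingy-lonely e
    ... | inj₂ lonely = lonely
    ... | inj₁ (_ , x-only) = sole-exit-lonely c~x e λ c~p → x-only _ _ (Reach-trans (Reach-sym F-sym c~x) c~p)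

    anchor? : ∀ x → Dec (∃ λ y → W x y ≡ true)
    anchor? x = any? λ y → W x y Bool.≟ true

    isAnchor : Fin n → Bool
    isAnchor x = does (anchor? x)

    -- partner x and leaf x are junk (x and []) unless x is an anchor of C.
    partner : Fin n → Fin n
    partner x with anchor? x
    ... | yes (y , _) = y
    ... | no _ = x

    partner-edge : ∀ {x} → isAnchor x ≡ true → W x (partner x) ≡ true
    partner-edge {x} with anchor? x
    ... | yes (_ , e) = λ _ → e

    edge-anchor : ∀ {x y} → W x y ≡ true → isAnchor x ≡ true
    edge-anchor {x} {y} e with anchor? x
    ... | yes _ = refl
    ... | no ∄y = ⊥-elim (∄y (y , e))

    OnLeaf : Fin n → Set
    OnLeaf v = ∃ λ x → Reach F c x × isAnchor x ≡ true × Reach F (partner x) v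

    C⊎OnLeaf-closed : ∀ {u w} → Reach F c u ⊎ OnLeaf u → (F ⊕ W) u w ≡ true → Reach F c w ⊎ OnLeaf w
    C⊎OnLeaf-closed {u} {w} at-u e with ∨-elim e | at-u
    ... | inj₁ Fuw | inj₁ c~u = inj₁ (Reach-trans c~u (step Fuw here))
    ... | inj₁ Fuw | inj₂ (x , c~x , x-anchor , x′~u) = inj₂ (x , c~x , x-anchor , Reach-trans x′~u (step Fuw here))
    ... | inj₂ Wuw | inj₁ c~u = inj₂ (u , c~u , edge-anchor Wuw ,
      subst (Reach F (partner u)) (W-neighbour-unique c~u (partner-edge (edge-anchor Wuw)) Wuw) here)
    ... | inj₂ Wuw | inj₂ (x , c~x , x-anchor , x′~u) =
      inj₁ (subst (Reach F c) (sym (proj₂ (proj₂ (leaf-lonely c~x (partner-edge x-anchor)) u w x′~u Wuw))) c~x)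

    K⊆C⊎OnLeaf : ∀ {v} → K v → Reach F c v ⊎ OnLeaf v
    K⊆C⊎OnLeaf r~v = along (Reach-trans (Reach-sym ⊕-sym (proj₁ c-centre)) r~v) (inj₁ here)
      where
      along : ∀ {u v} → Reach (F ⊕ W) u v → Reach F c u ⊎ OnLeaf u → Reach F c v ⊎ OnLeaf v
      along here at-u = at-u
      along (step e p) at-u = along p (C⊎OnLeaf-closed at-u e)

    anchor-in-centre : ∃ λ p → Reach F c p × isAnchor p ≡ true
    anchor-in-centre with proj₂ c-centre
    ... | inj₁ (_ , _ , _ , _ , (_ , u₁ , _ , c~u₁ , _ , e₁) , _) = u₁ , c~u₁ , edge-anchor e₁
    ... | inj₂ (d , Kd , c≁d , _) = exit (Reach-trans (Reach-sym ⊕-sym (proj₁ c-centre)) Kd) here c≁d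
      where
      exit : ∀ {u v} → Reach (F ⊕ W) u v → Reach F c u → ¬ Reach F c v →
             ∃ λ p → Reach F c p × isAnchor p ≡ true
      exit here c~u c≁v = ⊥-elim (c≁v c~u)
      exit (step e rest) c~u c≁v with ∨-elim e
      ... | inj₁ Fuw = exit rest (Reach-trans c~u (step Fuw here)) c≁v
      ... | inj₂ Wuw = _ , c~u , edge-anchor Wuw

    leaf : Fin n → List (Fin n)
    leaf x with F-shape (partner x)
    ... | inj₁ _ = []
    ... | inj₂ (_ , cy) = cycleList-to F cy

    record LeafWalk (x : Fin n) (ℓ : List (Fin n)) : Set where
      field
        leaf-traversal : Traversal F (partner x) ℓ
        leaf-length : length ℓ ≡ 4
        leaf-last : ∃ λ zs → ℓ ≡ zs ++ partner x ∷ []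

    leaf-walk : ∀ {x} → Reach F c x → isAnchor x ≡ true → LeafWalk x (leaf x)
    leaf-walk {x} c~x x-anchor with F-shape (partner x) | proj₁ (leaf-lonely c~x (partner-edge x-anchor))
    ... | inj₁ (_ , pa) | cycle₄ = ⊥-elim (path≢cycle pa cycle₄)
    ... | inj₂ (_ , cy) | cycle₄ = record
      { leaf-traversal = cycleList-to-traversal F cy
      ; leaf-length = hasSize-cong (Traversal-hasSize F (cycleList-to-traversal F cy)) (ComponentIsCycle-size cycle₄)
                                   (λ _ → Iff-refl)
      ; leaf-last = cycleList-to-last F cy
      }

    open Blocks isAnchor leaf

    expand-∈ : ∀ {x} → Reach F c x → ∀ v →
               Iff (v ∈ expand x) (v ≡ x ⊎ (isAnchor x ≡ true × Reach F (partner x) v))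
    expand-∈ {x} c~x v with isAnchor x in x-anchor
    ... | false = (λ { (here v≡x) → inj₁ v≡x }) , Sum.[ here , (λ ()) ∘ proj₁ ]
    ... | true = to , from
      where
      open Traversal (LeafWalk.leaf-traversal (leaf-walk c~x x-anchor))
      to : v ∈ leaf x ++ x ∷ [] → v ≡ x ⊎ (true ≡ true × Reach F (partner x) v)
      to v∈ with ∈-++⁻ (leaf x) v∈
      ... | inj₁ v∈leaf = inj₂ (refl , proj₂ (members v) v∈leaf)
      ... | inj₂ (here v≡x) = inj₁ v≡x
      from : v ≡ x ⊎ (true ≡ true × Reach F (partner x) v) → v ∈ leaf x ++ x ∷ []
      from (inj₁ v≡x) = ∈-++⁺ʳ (leaf x) (here v≡x)
      from (inj₂ (_ , x′~v)) = ∈-++⁺ˡ (proj₁ (members v) x′~v)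

    expand-unique : ∀ {x} → Reach F c x → Unique (expand x)
    expand-unique {x} c~x with isAnchor x in x-anchor
    ... | false = [] ∷ []
    ... | true = Uniqueₚ.++⁺ unique ([] ∷ []) λ { (x∈leaf , here refl) →
      W-separates (partner-edge x-anchor) (Reach-sym F-sym (proj₂ (members x) x∈leaf)) }
      where open Traversal (LeafWalk.leaf-traversal (leaf-walk c~x x-anchor))

    expand-disjoint : ∀ {x y} → Reach F c x → Reach F c y → ¬ x ≡ y → Disjoint (expand x) (expand y)
    expand-disjoint {x} {y} c~x c~y x≢y (v∈x , v∈y) with proj₁ (expand-∈ c~x _) v∈x | proj₁ (expand-∈ c~y _) v∈y
    ... | inj₁ refl | inj₁ refl = x≢y refl
    ... | inj₁ refl | inj₂ (y-anchor , y′~x) =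
      W-separates (partner-edge y-anchor) (Reach-trans (Reach-sym F-sym c~y) (Reach-trans c~x (Reach-sym F-sym y′~x)))
    ... | inj₂ (x-anchor , x′~y) | inj₁ refl =
      W-separates (partner-edge x-anchor) (Reach-trans (Reach-sym F-sym c~x) (Reach-trans c~y (Reach-sym F-sym x′~y)))
    ... | inj₂ (x-anchor , x′~v) | inj₂ (y-anchor , y′~v) =
      x≢y (proj₂ (proj₂ (leaf-lonely c~y (partner-edge y-anchor)) (partner x) x
        (Reach-trans y′~v (Reach-sym F-sym x′~v)) (W-sym _ _ (partner-edge x-anchor))))

    expansion-unique : ∀ {cs} → Unique cs → All (Reach F c) cs → Unique (concatMap expand cs)
    expansion-unique u in-C =
      Uniqueₚ.concat⁺ (Allₚ.map⁺ (All.map expand-unique in-C)) (AllPairs.map⁺ (pairwise in-C u))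
      where
      pairwise : ∀ {cs} → All (Reach F c) cs → Unique cs → AllPairs (λ x y → Disjoint (expand x) (expand y)) cs
      pairwise [] [] = []
      pairwise (c~x ∷ in-C) (x∉ ∷ u) = All.zipWith (disjoint-from c~x) (in-C , x∉) ∷ pairwise in-C u
        where
        disjoint-from : ∀ {x} → Reach F c x → ∀ {y} → Reach F c y × ¬ x ≡ y → Disjoint (expand x) (expand y)
        disjoint-from c~x (c~y , x≢y) = expand-disjoint c~x c~y x≢y

    expansion-members : ∀ {cs} → Traversal F c cs → ∀ v → Iff (K v) (v ∈ concatMap expand cs)
    expansion-members {cs} t v = to , from
      where
      open Traversal t
      into : ∀ {x} → Reach F c x → v ≡ x ⊎ (isAnchor x ≡ true × Reach F (partner x) v) → v ∈ concatMap expand cs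
      into c~x at-x = ∈-concat⁺′ (proj₂ (expand-∈ c~x v) at-x) (∈-map⁺ expand (proj₁ (members _) c~x))
      to : K v → v ∈ concatMap expand cs
      to Kv with K⊆C⊎OnLeaf Kv
      ... | inj₁ c~v = into c~v (inj₁ refl)
      ... | inj₂ (x , c~x , x-anchor , x′~v) = into c~x (inj₂ (x-anchor , x′~v))
      from : v ∈ concatMap expand cs → K v
      from v∈ with ∈-concat⁻′ (map expand cs) v∈
      ... | _ , v∈ys , ys∈ with ∈-map⁻ expand ys∈
      ...   | x , x∈cs , refl with proj₁ (expand-∈ (proj₂ (members x) x∈cs) v) v∈ys
      ...     | inj₁ refl = C⊆K (proj₂ (members x) x∈cs)
      ...     | inj₂ (x-anchor , x′~v) = K-F (K-W (C⊆K (proj₂ (members x) x∈cs)) (partner-edge x-anchor)) x′~v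

    open Orientation F F-sym F-shape using (edges≤vertices; edges<vertices)

    K-F-edge : ∀ {u v} → K u → F u v ≡ true → K v
    K-F-edge Ku e = K-F Ku (step e here)

    record CentreWalk : Set where
      field
        walk : List (Fin n)
        traversal : Traversal F c walk
        δ : ℕ
        edges+δ≤vertices : ∀ {N f} → HasSize K N → HasSize (FK F W r) f → f + δ ≤ N
        δ≡1-or-anchor-first : δ ≡ 1 ⊎ (δ ≡ 0 × proj₁ (split walk) ≡ [])

    centreWalk : CentreWalk
    centreWalk with F-shape c
    ... | inj₁ (_ , pa) = record
      { walk = pathList F pa
      ; traversal = pathList-traversal F pa
      ; δ = 1
      ; edges+δ≤vertices = λ {N} HK HF → subst (_≤ N) (+-comm 1 _) (edges<vertices K-F-edge HK HF (C⊆K here) pa)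
      ; δ≡1-or-anchor-first = inj₁ refl
      }
    ... | inj₂ (_ , cy) =
      let p , c~p , p-anchor = anchor-in-centre
          k , ys , walk≡ = cycleList-from F cy c~p
      in record
      { walk = cycleList F cy k
      ; traversal = cycleList-traversal F cy k
      ; δ = 0
      ; edges+δ≤vertices = λ {N} HK HF → subst (_≤ N) (sym (+-identityʳ _)) (edges≤vertices K-F-edge HK HF)
      ; δ≡1-or-anchor-first = inj₂ (refl , trans (cong (proj₁ ∘ split) walk≡) (split-from-anchor ys p-anchor))
      }

    module Pieces (cw : CentreWalk) where

      open CentreWalk cw
      open Traversal traversal renaming (walk to centre-walk)

      prefix : List (Fin n)
      prefix = proj₁ (split walk)

      blocks : List (List (Fin n))
      blocks = proj₂ (split walk)

      pieces : List (List (Fin n))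
      pieces = chunkAll (prefix ∷ blocks)

      concat-pieces : concat pieces ≡ concatMap expand walk
      concat-pieces = trans (concat-chunkAll (prefix ∷ blocks)) (split-flatten walk)

      pieces-unique : Unique (concat pieces)
      pieces-unique = subst Unique (sym concat-pieces) (expansion-unique unique (All.tabulate (proj₂ (members _))))

      K⇔pieces : ∀ v → Iff (K v) (v ∈ concat pieces)
      K⇔pieces v = let K⇔ = expansion-members traversal v in
        (λ Kv → subst (v ∈_) (sym concat-pieces) (proj₁ K⇔ Kv)) ,
        (λ v∈ → proj₂ K⇔ (subst (v ∈_) concat-pieces v∈))

      prefix-walk : Walk (F ⊕ W) prefix
      prefix-walk c′ = let t , walk≡ = split-prefix walk in
        ∨-introˡ (centre-walk (subst (λ l → Consecutive l _ _) (sym walk≡) (Consecutive-++ˡ t c′)))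

      block-walk : ∀ {b} → b ∈ blocks → Walk (F ⊕ W) b
      block-walk b∈ = subst (Walk (F ⊕ W)) (sym block≡) anchored
        where
        open Block (split-blocks walk b∈)
        open LeafWalk (leaf-walk (proj₂ (members anchor) anchor∈) is-anchor)
        anchored : Walk (F ⊕ W) (leaf anchor ++ anchor ∷ segment)
        anchored c′ with Consecutive-++⁻ (leaf anchor) c′
        ... | inj₁ c″ = ∨-introˡ (Traversal.walk leaf-traversal c″)
        ... | inj₂ (inj₁ c″) = ∨-introˡ (centre-walk (segment-consecutive c″))
        ... | inj₂ (inj₂ ((zs , leaf≡) , (_ , segment≡))) =
          let zs′ , leaf≡′ = leaf-last
              last≡partner = proj₂ (∷ʳ-injective zs zs′ (trans (sym leaf≡) leaf≡′))
          in ∨-introʳ {F _ _} (subst₂ (λ a b → W a b ≡ true) (sym last≡partner) (∷-injectiveˡ segment≡)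
                                      (W-sym _ _ (partner-edge is-anchor)))

      block-long : ∀ {b} → b ∈ blocks → 5 ≤ length b
      block-long {b} b∈ = begin
        5                                             ≤⟨ s≤s (s≤s (s≤s (s≤s (s≤s z≤n)))) ⟩
        4 + length (anchor ∷ segment)                 ≡⟨ cong (_+ length (anchor ∷ segment)) (sym leaf-length) ⟩
        length (leaf anchor) + length (anchor ∷ segment) ≡⟨ sym (length-++ (leaf anchor)) ⟩
        length (leaf anchor ++ anchor ∷ segment)      ≡⟨ cong length (sym block≡) ⟩
        length b                                      ∎
        where
        open ≤-Reasoning
        open Block (split-blocks walk b∈)
        open LeafWalk (leaf-walk (proj₂ (members anchor) anchor∈) is-anchor)

      pieces-walk : ∀ {π} → π ∈ pieces → Walk (F ⊕ W) π
      pieces-walk = Walk-chunkAll (prefix-walk ∷ All.tabulate block-walk)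

      prefix-count : 5 * length (Chunking.pieces (chunking prefix)) ≤ length prefix + 4 * δ
      prefix-count with δ≡1-or-anchor-first
      ... | inj₁ refl = Chunking.few-pieces (chunking prefix)
      ... | inj₂ (refl , prefix≡[]) =
        subst (λ xs → 5 * length (Chunking.pieces (chunking xs)) ≤ length xs + 4 * 0) (sym prefix≡[]) z≤n

      pieces-count : 5 * length pieces ≤ length (concat pieces) + 4 * δ
      pieces-count = subst (λ l → 5 * length pieces ≤ length l + 4 * δ) (sym (concat-chunkAll (prefix ∷ blocks)))
        (chunkAll-count-from {xs = prefix} {blocks} prefix-count (All.tabulate block-long))

      open PathsGraph pieces pieces-unique

      P-kpp : ∀ {k} → 9 ≤ k → IsKPP k F W r P
      P-kpp {k} 9≤k = (P-sym , spanning) , components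
        where
        spanning : ∀ u v → P u v ≡ true → (F ⊕ W) u v ≡ true × K u
        spanning u v e with P-edge⁻ e
        ... | π , π∈ , inj₁ c′ =
          pieces-walk π∈ c′ , proj₂ (K⇔pieces u) (∈-concat⁺′ (proj₁ (Consecutive-∈ c′)) π∈)
        ... | π , π∈ , inj₂ c′ =
          ⊕-sym _ _ (pieces-walk π∈ c′) , proj₂ (K⇔pieces u) (∈-concat⁺′ (proj₂ (Consecutive-∈ c′)) π∈)
        components : ∀ v → K v → ∃ λ m → m ≤ k × ComponentIsPath P v m
        components v Kv = let π , v∈π , π∈ = ∈-concat⁻′ pieces (proj₁ (K⇔pieces v) Kv) in
          length π , ≤-trans (proj₂ (chunkAll-bounded (prefix ∷ blocks) π∈)) 9≤k , piece-path π∈ v∈π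

      K-size : HasSize K (length (concat pieces))
      K-size = hasSize-fromList (concat pieces) pieces-unique K⇔pieces

      FK-size : ∃ (HasSize (FK F W r))
      FK-size = hasSize-decidable (cartesianProduct (allFin n) (allFin n))
        (Uniqueₚ.cartesianProduct⁺ (Uniqueₚ.allFin⁺ n) (Uniqueₚ.allFin⁺ n))
        (λ (u , v) → ∈-cartesianProduct⁺ (∈-allFin u) (∈-allFin v))
        λ (u , v) → (toℕ u <? toℕ v) ×-dec (F u v Bool.≟ true) ×-dec hasSize⇒dec K-size u

      result : ∀ {k} → 9 ≤ k →
               ∃ λ P → IsKPP k F W r P × ∃ λ p → ∃ λ f → NumEdges P p × HasSize (FK F W r) f × 4 * f ≤ 5 * p
      result 9≤k = let f , FK-hasSize = FK-size in
        P , P-kpp 9≤k , _ , f , P-edges , FK-hasSize ,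
        four-fifths {δ = δ} {pc = length pieces} (edges+δ≤vertices K-size FK-hasSize) pieces-count
                    (sum-pred-length pieces (All.tabulate (proj₁ ∘ chunkAll-bounded (prefix ∷ blocks))))

lemma8 : (k n : ℕ) → (k ≡ 9 ⊎ k ≡ 10) → (G F W : Graph n) → SimpleGraph G
    → MaxTFPCC G F → OptimalW G F W → (r c : Fin n)
    → NotSingleNode F W r → IsCenter F W r c → NoTwoAnchor F W c
    → ∃ λ P → IsKPP k F W r P
        × ∃ λ p → ∃ λ f → NumEdges P p × HasSize (FK F W r) f × 4 * f ≤ 5 * p
lemma8 k n k≡9⊎10 G F W _ (F-cover , _) W-optimal r c _ c-centre no-2-anchor =
  Pieces.result centreWalk 9≤k
  where
  open StingyCover G F W F-cover W-optimal
  open Centre r c c-centre no-2-anchor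
  9≤k : 9 ≤ k
  9≤k = Sum.[ (λ { refl → ≤-refl }) , (λ { refl → n≤1+n 9 }) ] k≡9⊎10
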